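{- Let $n\geq1$ and let $w=C_k(s_n)$ for some $k\in[0,q_n-1]$. Then $\mathrm{occ}_1(w)=k$ and, for all $i\ge1$, $\mathrm{occ}_{i+1}(w)=\mathrm{occ}_i(w)+P_i$, where $(P_i)_{i\ge1}$ is $c_{\alpha_{n,1}}\{q_n,q_{n-1}\}$ if $k\in[0,q_{n-1}-2]$, and is $c_{\alpha_n}\{q_n,q_n+q_{n-1}\}$ if $k\in[q_{n-1}-1,q_n-1]$.
   Context: Words over $\{a,b\}$. For a word $w=x_1\cdots x_m$ and $0\le k\le m-1$, $C_k(w)=x_{k+1}\cdots x_mx_1\cdots x_k$. $\mathrm{occ}_i(w)$ is the position (positions start at $0$) of the $i$-th occurrence of $w$ in $c_\alpha$. For an irrational $\gamma\in(0,1)$, $c_\gamma$ is the infinite word with $c_\gamma(n)=a$ if $\lfloor (n+2)\gamma\rfloor-\lfloor (n+1)\gamma\rfloor=0$ and $b$ otherwise. For $\gamma=[0;a_1,a_2,\ldots]$, $n\in\mathbb{N}$, integer $k\ge1-a_{n+1}$: $\gamma_{n,k}=[0;a_{n+1}+k,a_{n+2},\ldots]$, $\gamma_n=\gamma_{n,0}$. $\mathbf{c}\{x,y\}$ is the sequence obtained from $\mathbf{c}$ by replacing $a$ by $x$ and $b$ by $y$. Standing assumption: $\alpha=[0;1+d_1,d_2,d_3,\ldots]$ irrational, all integers $d_i\ge1$ (so $a_1=1+d_1$, $a_i=d_i$ for $i\ge2$). $s_{ -1}=b$, $s_0=a$, $s_n=s_{n-1}^{d_n}s_{n-2}$ ($n\ge1$);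 $q_n=|s_n|$ for $n\ge0$, $q_{ -1}=1$; $c_\alpha=\lim_n s_n$. -}

module Defs where

open import Data.Nat using (ℕ; zero; suc; _+_; _*_; _∸_; _≤_; _<_)
open import Data.List using (List; []; _∷_; _++_; length; drop; take; map; upTo; filter; replicate; concat)
open import Data.List.Properties using (≡-dec)
open import Data.Product using (Σ; ∃; _×_; _,_)
open import Relation.Binary.PropositionalEquality using (_≡_; _≢_)
open import Relation.Nullary using (Dec; yes; no)

data Letter : Set where
  a b : Letter

_≟L_ : (x y : Letter) → Dec (x ≡ y)
a ≟L a = yes _≡_.refl
a ≟L b = no (λ ())
b ≟L a = no (λ ())
b ≟L b = yes _≡_.refl

Word : Set
Word = List Letter

_≟W_ : (u v : Word) → Dec (u ≡ v)
_≟W_ = ≡-dec _≟L_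

pow : Word → ℕ → Word
pow u zero    = []
pow u (suc m) = u ++ pow u m

C : ℕ → Word → Word
C k w = drop k w ++ take k w

-- safe indexing with default letter (only used in range)
nthOr : Letter → Word → ℕ → Letter
nthOr x []       _       = x
nthOr x (y ∷ ys) zero    = y
nthOr x (y ∷ ys) (suc i) = nthOr x ys i

-- Standard words of α = [0; 1+d₁, d₂, d₃, …]   (d i = d_i, i ≥ 1; d 0 unused)

-- sw d m = s_{m-1}   (so sw d 0 = s_{-1} = b, sw d 1 = s_0 = a)
sw : (ℕ → ℕ) → ℕ → Word
sw d zero          = b ∷ []
sw d (suc zero)    = a ∷ []
sw d (suc (suc m)) = pow (sw d (suc m)) (d (suc m)) ++ sw d m

s : (ℕ → ℕ) → ℕ → Word
s d n = sw d (suc n)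

q : (ℕ → ℕ) → ℕ → ℕ
q d n = length (s d n)

-- q_{n-1} = |s_{n-1}| for n ≥ 0 (with q_{-1} = |b| = 1)
qprev : (ℕ → ℕ) → ℕ → ℕ
qprev d n = length (sw d n)

-- c_α = lim s_n : letter m of c_α is letter m of s_{m+1} (|s_{m+1}| > m)
cα : (ℕ → ℕ) → ℕ → Letter
cα d m = nthOr a (s d (suc m)) m

factor : (ℕ → ℕ) → ℕ → ℕ → Word
factor d p l = map (λ j → cα d (p + j)) (upTo l)

Occurs : (ℕ → ℕ) → Word → ℕ → Set
Occurs d w p = factor d p (length w) ≡ w

occCount : (ℕ → ℕ) → Word → ℕ → ℕ
occCount d w p = length (filter (λ t → factor d t (length w) ≟W w) (upTo p))

-- IsOcc d w i p  :⇔  occ_i(w) = p   (for i ≥ 1): w occurs at p and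
-- exactly i-1 occurrences of w start before p
IsOcc : (ℕ → ℕ) → Word → ℕ → ℕ → Set
IsOcc d w i p = Occurs d w p × occCount d w p ≡ i ∸ 1

-- Irrationals in (0,1) given by continued fractions γ = [0; e 1, e 2, …]
-- (e i ≥ 1 for i ≥ 1; e 0 unused)

-- numerators / denominators of convergents p_k/q_k, k ≥ 0
-- (p_{-1}=1, q_{-1}=0, p_0=0, q_0=1, p_k = e_k p_{k-1} + p_{k-2})
cfP : (ℕ → ℕ) → ℕ → ℕ
cfP e zero          = 0
cfP e (suc zero)    = 1
cfP e (suc (suc k)) = e (suc (suc k)) * cfP e (suc k) + cfP e k

cfQ : (ℕ → ℕ) → ℕ → ℕ
cfQ e zero          = 1
cfQ e (suc zero)    = e 1
cfQ e (suc (suc k)) = e (suc (suc k)) * cfQ e (suc k) + cfQ e k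

-- j/m < γ   (even convergents increase strictly to γ)
RatBelow : (ℕ → ℕ) → ℕ → ℕ → Set
RatBelow e j m = ∃ λ k → j * cfQ e (2 * k) ≤ cfP e (2 * k) * m

-- γ < j/m   (odd convergents decrease strictly to γ)
RatAbove : (ℕ → ℕ) → ℕ → ℕ → Set
RatAbove e j m = ∃ λ k → cfP e (suc (2 * k)) * m ≤ j * cfQ e (suc (2 * k))

-- j = ⌊ m γ ⌋  (m ≥ 1; γ irrational so j ≤ mγ ⇔ j/m < γ)
IsFloor : (ℕ → ℕ) → ℕ → ℕ → Set
IsFloor e m j = RatBelow e j m × RatAbove e (suc j) m

CharLetter : (ℕ → ℕ) → ℕ → Letter → Set
CharLetter e t a = ∃ λ j → IsFloor e (t + 2) j × IsFloor e (t + 1) j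
CharLetter e t b = Σ ℕ λ j → Σ ℕ λ j' → IsFloor e (t + 2) j × IsFloor e (t + 1) j' × j ≢ j'

aα : (ℕ → ℕ) → ℕ → ℕ
aα d (suc zero) = suc (d 1)
aα d i          = d i

-- partial quotients of α_{n,k} = [0; a_{n+1}+k, a_{n+2}, …]   (k ≥ 0 here)
αcf : (ℕ → ℕ) → ℕ → ℕ → (ℕ → ℕ)
αcf d n k zero          = 0
αcf d n k (suc zero)    = aα d (suc n) + k
αcf d n k (suc (suc i)) = aα d (suc (suc (n + i)))

-- The gap predicate: P_i is c_γ{x,y}(i-1), and occ_{i+1}(w) = occ_i(w) + P_i
GapStep : (ℕ → ℕ) → Word → (ℕ → ℕ) → ℕ → ℕ → ℕ → ℕ → Set
GapStep d w e x y i p =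
  (CharLetter e (i ∸ 1) a → IsOcc d w (suc i) (p + x)) ×
  (CharLetter e (i ∸ 1) b → IsOcc d w (suc i) (p + y))

module Submission where

-- Fix n ≥ 1, X = s_n, Y = s_{n-1}.  The characteristic word c_α is
-- the concatenation μ(u) of blocks X (for a) and Y (for b) along the limit u
-- of the standard words with exponents d_{n+1}, d_{n+2}, …; moreover u = τ(u')
-- for τ : a ↦ a, b ↦ ab.  Identifying characteristic words with limits of
-- standard words (via the floor description of the number of b's) shows
-- u = c_{α_{n,1}} and u' = c_{α_n}.  Since |X| and |X|_b are coprime, X is
-- primitive, so w can only occur at offset k of a block: in every X-block, and
-- in a Y-block exactly when k + 2 ≤ q_{n-1} (otherwise the factor starting at
-- offset q_{n-1} - 1 has the wrong number of b's).  Counting occurrences block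
-- by block then gives occ_1(w) = k and the gaps q_n, q_{n-1} along u, resp.
-- q_n, q_n + q_{n-1} along u'.

open import Defs
open import Data.Nat using (ℕ; _+_; _≤_; _<_)
open import Data.Product using (_×_)

open import Function using (_∘_)
open import Data.Nat using (zero; suc; _*_; _∸_; z≤n; s≤s; _≤?_; _<?_)
open import Data.Nat.Properties
open import Data.Nat.Tactic.RingSolver using (solve-∀)
open import Data.List using ([]; _∷_; _++_; length; take; drop; filter; upTo; applyUpTo)
open import Data.List.Properties using (length-++; ++-assoc; ++-identityʳ; ++-cancelˡ; ∷ʳ-injective; ∷-injectiveˡ; ∷-injectiveʳ; map-applyUpTo; upTo-∷ʳ; filter-++; filter-accept; filter-reject; take++drop≡id; length-take)
open import Data.Product using (Σ; _,_; proj₁; proj₂)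
open import Data.Sum using (_⊎_; inj₁; inj₂)
open import Data.Empty using (⊥; ⊥-elim)
open import Relation.Binary.PropositionalEquality using (_≡_; _≢_; refl; sym; trans; cong; cong₂; subst; subst₂; module ≡-Reasoning)
open import Relation.Binary.Definitions using (tri<; tri≈; tri>)
open import Relation.Nullary using (¬_; Dec; yes; no)

module Words where

  infixl 9 _!_
  infix 4 _⊑_

  -- Letter i of a word (the default a is only ever read outside the word).
  _!_ : Word → ℕ → Letter
  w ! i = nthOr a w i

  !-++ˡ : ∀ u v i → i < length u → (u ++ v) ! i ≡ u ! i
  !-++ˡ (x ∷ u) v zero    _       = refl
  !-++ˡ (x ∷ u) v (suc i) (s≤s p) = !-++ˡ u v i p

  !-++ʳ : ∀ u v i → (u ++ v) ! (length u + i) ≡ v ! i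
  !-++ʳ []      v i = refl
  !-++ʳ (x ∷ u) v i = !-++ʳ u v i

  word-ext : ∀ u v → length u ≡ length v → (∀ i → i < length u → u ! i ≡ v ! i) → u ≡ v
  word-ext []      []      _  _ = refl
  word-ext (x ∷ u) (y ∷ v) eq f =
    cong₂ _∷_ (f 0 (s≤s z≤n)) (word-ext u v (suc-injective eq) (λ i p → f (suc i) (s≤s p)))

  #b : Word → ℕ
  #b []      = 0
  #b (a ∷ w) = #b w
  #b (b ∷ w) = suc (#b w)

  #b-++ : ∀ u v → #b (u ++ v) ≡ #b u + #b v
  #b-++ []      v = refl
  #b-++ (a ∷ u) v = #b-++ u v
  #b-++ (b ∷ u) v = cong suc (#b-++ u v)

  #b-comm : ∀ u v → #b (u ++ v) ≡ #b (v ++ u)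
  #b-comm u v = trans (#b-++ u v) (trans (+-comm (#b u) (#b v)) (sym (#b-++ v u)))

  length-comm : ∀ (u v : Word) → length (u ++ v) ≡ length (v ++ u)
  length-comm u v = trans (length-++ u) (trans (+-comm (length u) (length v)) (sym (length-++ v)))

  _⊑_ : Word → Word → Set
  u ⊑ v = Σ Word λ z → v ≡ u ++ z

  ⊑-refl : ∀ u → u ⊑ u
  ⊑-refl u = [] , sym (++-identityʳ u)

  ⊑-++ : ∀ u z → u ⊑ u ++ z
  ⊑-++ u z = z , refl

  ⊑-trans : ∀ {u v w} → u ⊑ v → v ⊑ w → u ⊑ w
  ⊑-trans {u} (z , refl) (z' , refl) = z ++ z' , ++-assoc u z z'

  ⊑-cong : ∀ x {u v} → u ⊑ v → x ++ u ⊑ x ++ v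
  ⊑-cong x {u} (z , refl) = z , sym (++-assoc x u z)

  ⊑-length : ∀ {u v} → u ⊑ v → length u ≤ length v
  ⊑-length {u} (z , refl) = subst (length u ≤_) (sym (length-++ u)) (m≤m+n _ _)

  ⊑-! : ∀ {u v} → u ⊑ v → ∀ i → i < length u → u ! i ≡ v ! i
  ⊑-! {u} (z , refl) i p = sym (!-++ˡ u z i p)

  ⊑-by-length : ∀ u w v → u ⊑ v → w ⊑ v → length u ≤ length w → u ⊑ w
  ⊑-by-length []      w       v                 _        _        _       = w , refl
  ⊑-by-length (x ∷ u) (y ∷ w) .((x ∷ u) ++ z) (z , refl) (z' , e) (s≤s le)
    with refl ← ∷-injectiveˡ e =
    let (z'' , e'') = ⊑-by-length u w (u ++ z) (z , refl) (z' , ∷-injectiveʳ e) le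
    in z'' , cong (x ∷_) e''

  unsnoc : ∀ (w : Word) → 1 ≤ length w → Σ Word λ u → Σ Letter λ c → w ≡ u ++ c ∷ []
  unsnoc (x ∷ [])     _ = [] , x , refl
  unsnoc (x ∷ y ∷ w) _ with unsnoc (y ∷ w) (s≤s z≤n)
  ... | u , c , e = x ∷ u , c , cong (x ∷_) e

  C-++ : ∀ (u v : Word) → C (length u) (u ++ v) ≡ v ++ u
  C-++ u v = cong₂ _++_ (drop-++ u) (take-++ u)
    where
    drop-++ : ∀ u → drop (length u) (u ++ v) ≡ v
    drop-++ []      = refl
    drop-++ (x ∷ u) = drop-++ u
    take-++ : ∀ u → take (length u) (u ++ v) ≡ u
    take-++ []      = refl
    take-++ (x ∷ u) = cong (x ∷_) (take-++ u)

  length-C : ∀ r w → length (C r w) ≡ length w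
  length-C r w = trans (length-comm (drop r w) (take r w)) (cong length (take++drop≡id r w))

  #b-C : ∀ r w → #b (C r w) ≡ #b w
  #b-C r w = trans (#b-comm (drop r w) (take r w)) (cong #b (take++drop≡id r w))

  splitAt : ∀ (w : Word) r → r ≤ length w → Σ Word λ u → Σ Word λ v → w ≡ u ++ v × length u ≡ r
  splitAt w r p = take r w , drop r w , sym (take++drop≡id r w) , trans (length-take r w) (m≤n⇒m⊓n≡m p)


  OccursIn : (ℕ → Letter) → ℕ → Word → Set
  OccursIn T p w = ∀ i → i < length w → T (p + i) ≡ w ! i

  private
    <-length-++ˡ : ∀ (u v : Word) i → i < length u → i < length (u ++ v)
    <-length-++ˡ u v i p = subst (i <_) (sym (length-++ u {v})) (≤-trans p (m≤m+n _ _))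

  OccursIn-++ˡ : ∀ T p u v → OccursIn T p (u ++ v) → OccursIn T p u
  OccursIn-++ˡ T p u v h i i<u = trans (h i (<-length-++ˡ u v i i<u)) (!-++ˡ u v i i<u)

  OccursIn-++ʳ : ∀ T p u v → OccursIn T p (u ++ v) → OccursIn T (p + length u) v
  OccursIn-++ʳ T p u v h i i<v =
    trans (cong T (+-assoc p (length u) i))
      (trans (h (length u + i) (subst (length u + i <_) (sym (length-++ u {v})) (+-monoʳ-< (length u) i<v)))
        (!-++ʳ u v i))

  OccursIn-⊑ : ∀ T p u v → u ⊑ v → OccursIn T p v → OccursIn T p u
  OccursIn-⊑ T p u .(u ++ z) (z , refl) = OccursIn-++ˡ T p u z

  below-or-offset : ∀ m i → i < m ⊎ Σ ℕ (λ j → i ≡ m + j)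
  below-or-offset zero    i       = inj₂ (i , refl)
  below-or-offset (suc m) zero    = inj₁ (s≤s z≤n)
  below-or-offset (suc m) (suc i) with below-or-offset m i
  ... | inj₁ p       = inj₁ (s≤s p)
  ... | inj₂ (j , e) = inj₂ (j , cong suc e)

  OccursIn-join : ∀ T p u v → OccursIn T p u → OccursIn T (p + length u) v → OccursIn T p (u ++ v)
  OccursIn-join T p u v hu hv i i<uv with below-or-offset (length u) i
  ... | inj₁ i<u = trans (hu i i<u) (sym (!-++ˡ u v i i<u))
  ... | inj₂ (j , refl) =
    trans (sym (cong T (+-assoc p (length u) j)))
      (trans (hv j (+-cancelˡ-< (length u) j (length v) (subst (length u + j <_) (length-++ u {v}) i<uv)))
        (sym (!-++ʳ u v j)))

  OccursIn-unique : ∀ T p u v → OccursIn T p u → OccursIn T p v → length u ≡ length v → u ≡ v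
  OccursIn-unique T p u v hu hv e = word-ext u v e (λ i q → trans (sym (hu i q)) (hv i (subst (i <_) e q)))

  private
    applyUpTo→! : ∀ (g : ℕ → Letter) l w → applyUpTo g l ≡ w → ∀ i → i < l → g i ≡ w ! i
    applyUpTo→! g (suc l) _ refl zero    _       = refl
    applyUpTo→! g (suc l) _ refl (suc i) (s≤s p) = applyUpTo→! (g ∘ suc) l _ refl i p

    !→applyUpTo : ∀ (g : ℕ → Letter) w → (∀ i → i < length w → g i ≡ w ! i) → applyUpTo g (length w) ≡ w
    !→applyUpTo g []      h = refl
    !→applyUpTo g (x ∷ w) h = cong₂ _∷_ (h 0 (s≤s z≤n)) (!→applyUpTo (g ∘ suc) w (λ i p → h (suc i) (s≤s p)))

  Occurs→OccursIn : ∀ d w p → Occurs d w p → OccursIn (cα d) p w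
  Occurs→OccursIn d w p h = applyUpTo→! (λ j → cα d (p + j)) (length w) w
    (trans (sym (map-applyUpTo (λ x → x) (λ j → cα d (p + j)) (length w))) h)

  OccursIn→Occurs : ∀ d w p → OccursIn (cα d) p w → Occurs d w p
  OccursIn→Occurs d w p h =
    trans (map-applyUpTo (λ x → x) (λ j → cα d (p + j)) (length w)) (!→applyUpTo (λ j → cα d (p + j)) w h)

-- Arithmetic of fractions, all stated by cross-multiplication in ℕ.
module FractionArithmetic where

  *-swapʳ : ∀ x y z → x * y * z ≡ x * z * y
  *-swapʳ = solve-∀

  -- The recursion (P, Q) ↦ (k P₁ + P₀, k Q₁ + Q₀) of continued-fraction
  -- convergents and of standard words preserves the determinant ±1.
  unimodular-step₁ : ∀ k B₀ B₁ L₀ L₁ → B₀ * L₁ ≡ B₁ * L₀ + 1 → (k * B₁ + B₀) * L₁ ≡ B₁ * (k * L₁ + L₀) + 1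
  unimodular-step₁ k B₀ B₁ L₀ L₁ h = begin
    (k * B₁ + B₀) * L₁          ≡⟨ *-distribʳ-+ L₁ (k * B₁) B₀ ⟩
    k * B₁ * L₁ + B₀ * L₁       ≡⟨ cong (k * B₁ * L₁ +_) h ⟩
    k * B₁ * L₁ + (B₁ * L₀ + 1) ≡⟨ rearrange k B₁ L₀ L₁ ⟩
    B₁ * (k * L₁ + L₀) + 1      ∎
    where
    open ≡-Reasoning
    rearrange : ∀ k B₁ L₀ L₁ → k * B₁ * L₁ + (B₁ * L₀ + 1) ≡ B₁ * (k * L₁ + L₀) + 1
    rearrange = solve-∀

  unimodular-step₂ : ∀ k B₀ B₁ L₀ L₁ → B₁ * L₀ ≡ B₀ * L₁ + 1 → B₁ * (k * L₁ + L₀) ≡ (k * B₁ + B₀) * L₁ + 1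
  unimodular-step₂ k B₀ B₁ L₀ L₁ h = begin
    B₁ * (k * L₁ + L₀)          ≡⟨ rearrange₁ k B₁ L₀ L₁ ⟩
    k * B₁ * L₁ + B₁ * L₀       ≡⟨ cong (k * B₁ * L₁ +_) h ⟩
    k * B₁ * L₁ + (B₀ * L₁ + 1) ≡⟨ rearrange₂ k B₀ B₁ L₁ ⟩
    (k * B₁ + B₀) * L₁ + 1      ∎
    where
    open ≡-Reasoning
    rearrange₁ : ∀ k B₁ L₀ L₁ → B₁ * (k * L₁ + L₀) ≡ k * B₁ * L₁ + B₁ * L₀
    rearrange₁ = solve-∀
    rearrange₂ : ∀ k B₀ B₁ L₁ → k * B₁ * L₁ + (B₀ * L₁ + 1) ≡ (k * B₁ + B₀) * L₁ + 1
    rearrange₂ = solve-∀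

  frac-≤-≤ : ∀ p q p' q' p'' q'' → 1 ≤ q' → p * q' ≤ p' * q → p' * q'' ≤ p'' * q' → p * q'' ≤ p'' * q
  frac-≤-≤ p q p' (suc q') p'' q'' _ h₁ h₂ = *-cancelʳ-≤ (p * q'') (p'' * q) (suc q') (begin
    p * q'' * suc q'  ≡⟨ *-swapʳ p q'' (suc q') ⟩
    p * suc q' * q''  ≤⟨ *-monoˡ-≤ q'' h₁ ⟩
    p' * q * q''      ≡⟨ *-swapʳ p' q q'' ⟩
    p' * q'' * q      ≤⟨ *-monoˡ-≤ q h₂ ⟩
    p'' * suc q' * q  ≡⟨ *-swapʳ p'' (suc q') q ⟩
    p'' * q * suc q'  ∎)
    where open ≤-Reasoning

  frac-≤-< : ∀ p q p' q' p'' q'' → 1 ≤ q → p * q' ≤ p' * q → p' * q'' < p'' * q' → p * q'' < p'' * q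
  frac-≤-< p (suc q) p' q' p'' q'' _ h₁ h₂ = *-cancelʳ-< q' (p * q'') (p'' * suc q) (begin-strict
    p * q'' * q'      ≡⟨ *-swapʳ p q'' q' ⟩
    p * q' * q''      ≤⟨ *-monoˡ-≤ q'' h₁ ⟩
    p' * suc q * q''  ≡⟨ *-swapʳ p' (suc q) q'' ⟩
    p' * q'' * suc q  <⟨ *-monoˡ-< (suc q) h₂ ⟩
    p'' * q' * suc q  ≡⟨ *-swapʳ p'' q' (suc q) ⟩
    p'' * suc q * q'  ∎)
    where open ≤-Reasoning

  frac-<-≤ : ∀ p q p' q' p'' q'' → 1 ≤ q'' → p * q' < p' * q → p' * q'' ≤ p'' * q' → p * q'' < p'' * q
  frac-<-≤ p q p' q' p'' (suc q'') _ h₁ h₂ = *-cancelʳ-< q' (p * suc q'') (p'' * q) (begin-strict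
    p * suc q'' * q'  ≡⟨ *-swapʳ p (suc q'') q' ⟩
    p * q' * suc q''  <⟨ *-monoˡ-< (suc q'') h₁ ⟩
    p' * q * suc q''  ≡⟨ *-swapʳ p' q (suc q'') ⟩
    p' * suc q'' * q  ≤⟨ *-monoˡ-≤ q h₂ ⟩
    p'' * q' * q      ≡⟨ *-swapʳ p'' q' q ⟩
    p'' * q * q'      ∎)
    where open ≤-Reasoning

  mediant-bound : ∀ P Q P' Q' x j → P' * Q ≡ P * Q' + 1 → x * P < j * Q → j * Q' < x * P' → Q + Q' ≤ x
  mediant-bound P Q P' Q' x j det h₁ h₂ = subst (Q + Q' ≤_) (sym x≡) (+-mono-≤ (m≤m*n Q (suc B)) (m≤m*n Q' (suc A)))
    where
    A = proj₁ (m≤n⇒∃[o]m+o≡n h₁)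
    B = proj₁ (m≤n⇒∃[o]m+o≡n h₂)
    hA : suc (x * P) + A ≡ j * Q
    hA = proj₂ (m≤n⇒∃[o]m+o≡n h₁)
    hB : suc (j * Q') + B ≡ x * P'
    hB = proj₂ (m≤n⇒∃[o]m+o≡n h₂)
    S₁ : ∀ x P Q' → x * P * Q' + x ≡ x * (P * Q' + 1)
    S₁ = solve-∀
    S₂ : ∀ x P' Q → x * (P' * Q) ≡ Q * (x * P')
    S₂ = solve-∀
    S₃ : ∀ Q Q' j B → Q * (suc (j * Q') + B) ≡ Q' * (j * Q) + Q * suc B
    S₃ = solve-∀
    S₄ : ∀ Q Q' x P A B → Q' * (suc (x * P) + A) + Q * suc B ≡ x * P * Q' + (Q * suc B + Q' * suc A)
    S₄ = solve-∀
    x≡ : x ≡ Q * suc B + Q' * suc A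
    x≡ = +-cancelˡ-≡ (x * P * Q') x _ (begin
      x * P * Q' + x                       ≡⟨ S₁ x P Q' ⟩
      x * (P * Q' + 1)                     ≡⟨ cong (x *_) (sym det) ⟩
      x * (P' * Q)                         ≡⟨ S₂ x P' Q ⟩
      Q * (x * P')                         ≡⟨ cong (Q *_) (sym hB) ⟩
      Q * (suc (j * Q') + B)               ≡⟨ S₃ Q Q' j B ⟩
      Q' * (j * Q) + Q * suc B             ≡⟨ cong (λ z → Q' * z + Q * suc B) (sym hA) ⟩
      Q' * (suc (x * P) + A) + Q * suc B   ≡⟨ S₄ Q Q' x P A B ⟩
      x * P * Q' + (Q * suc B + Q' * suc A) ∎)
      where open ≡-Reasoning

  Floor : ℕ → ℕ → ℕ → ℕ → Set
  Floor P Q x j = j * Q ≤ x * P × x * P < suc j * Q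

  -- j < x P / Q ≤ j + 1, i.e. j = ⌈x P / Q⌉ - 1.
  Ceil : ℕ → ℕ → ℕ → ℕ → Set
  Ceil P Q x j = j * Q < x * P × x * P ≤ suc j * Q

  Floor⇒Ceil : ∀ P Q P' Q' x j → P' * Q ≡ P * Q' + 1 → 1 ≤ x → x < Q + Q' → Floor P Q x j → Ceil P' Q' x j
  Floor⇒Ceil P Q P' Q' x j det 1≤x x< (g₁ , g₂) = lower , upper
    where
    S : ∀ x P Q' → x * (P * Q' + 1) ≡ x * P * Q' + x
    S = solve-∀
    lower : j * Q' < x * P'
    lower = *-cancelʳ-< Q (j * Q') (x * P') (begin-strict
      j * Q' * Q       ≡⟨ *-swapʳ j Q' Q ⟩
      j * Q * Q'       ≤⟨ *-monoˡ-≤ Q' g₁ ⟩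
      x * P * Q'       <⟨ m<m+n (x * P * Q') 1≤x ⟩
      x * P * Q' + x   ≡⟨ sym (S x P Q') ⟩
      x * (P * Q' + 1) ≡⟨ cong (x *_) (sym det) ⟩
      x * (P' * Q)     ≡⟨ sym (*-assoc x P' Q) ⟩
      x * P' * Q       ∎)
      where open ≤-Reasoning
    upper : x * P' ≤ suc j * Q'
    upper with x * P' ≤? suc j * Q'
    ... | yes le = le
    ... | no  gt = ⊥-elim (<⇒≱ x< (mediant-bound P Q P' Q' x (suc j) det g₂ (≰⇒> gt)))

  Ceil⇒Floor : ∀ P Q P' Q' x j → P * Q' ≡ P' * Q + 1 → 1 ≤ x → x < Q + Q' → Ceil P Q x j → Floor P' Q' x j
  Ceil⇒Floor P Q P' Q' x j det 1≤x x< (g₁ , g₂) = lower , upper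
    where
    S : ∀ x P' Q → x * (P' * Q + 1) ≡ x * P' * Q + x
    S = solve-∀
    upper : x * P' < suc j * Q'
    upper = *-cancelʳ-< Q (x * P') (suc j * Q') (begin-strict
      x * P' * Q       <⟨ m<m+n (x * P' * Q) 1≤x ⟩
      x * P' * Q + x   ≡⟨ sym (S x P' Q) ⟩
      x * (P' * Q + 1) ≡⟨ cong (x *_) (sym det) ⟩
      x * (P * Q')     ≡⟨ sym (*-assoc x P Q') ⟩
      x * P * Q'       ≤⟨ *-monoˡ-≤ Q' g₂ ⟩
      suc j * Q * Q'   ≡⟨ *-swapʳ (suc j) Q Q' ⟩
      suc j * Q' * Q   ∎)
      where open ≤-Reasoning
    lower : j * Q' ≤ x * P'
    lower with j * Q' ≤? x * P'
    ... | yes le = le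
    ... | no  gt = ⊥-elim (<⇒≱ x< (subst (_≤ x) (+-comm Q' Q) (mediant-bound P' Q' P Q x j det (≰⇒> gt) g₁)))

  private
    S₁ : ∀ P Q j → P * Q + j * Q ≡ (P + j) * Q
    S₁ = solve-∀
    S₂ : ∀ P Q x → P * Q + x * P ≡ (Q + x) * P
    S₂ = solve-∀
    S₃ : ∀ P Q j → P * Q + suc j * Q ≡ suc (P + j) * Q
    S₃ = solve-∀

  Floor-shift : ∀ P Q x j → Floor P Q x j → Floor P Q (Q + x) (P + j)
  Floor-shift P Q x j (g₁ , g₂) =
    subst₂ _≤_ (S₁ P Q j) (S₂ P Q x) (+-monoʳ-≤ (P * Q) g₁) ,
    subst₂ _<_ (S₂ P Q x) (S₃ P Q j) (+-monoʳ-< (P * Q) g₂)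

  Ceil-shift : ∀ P Q x j → Ceil P Q x j → Ceil P Q (Q + x) (P + j)
  Ceil-shift P Q x j (g₁ , g₂) =
    subst₂ _<_ (S₁ P Q j) (S₂ P Q x) (+-monoʳ-< (P * Q) g₁) ,
    subst₂ _≤_ (S₂ P Q x) (S₃ P Q j) (+-monoʳ-≤ (P * Q) g₂)

  private
    S₄ : ∀ E P₀ Q₀ Q₁ → E * (P₀ * Q₁) + P₀ * Q₀ ≡ P₀ * (E * Q₁ + Q₀)
    S₄ = solve-∀
    S₅ : ∀ E P₀ P₁ Q₀ → E * (P₁ * Q₀) + P₀ * Q₀ ≡ (E * P₁ + P₀) * Q₀
    S₅ = solve-∀

  mediant-≥ : ∀ E P₀ P₁ Q₀ Q₁ → P₀ * Q₁ ≤ P₁ * Q₀ → P₀ * (E * Q₁ + Q₀) ≤ (E * P₁ + P₀) * Q₀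
  mediant-≥ E P₀ P₁ Q₀ Q₁ h = subst₂ _≤_ (S₄ E P₀ Q₀ Q₁) (S₅ E P₀ P₁ Q₀) (+-monoˡ-≤ (P₀ * Q₀) (*-monoʳ-≤ E h))

  mediant-≤ : ∀ E P₀ P₁ Q₀ Q₁ → P₁ * Q₀ ≤ P₀ * Q₁ → (E * P₁ + P₀) * Q₀ ≤ P₀ * (E * Q₁ + Q₀)
  mediant-≤ E P₀ P₁ Q₀ Q₁ h = subst₂ _≤_ (S₅ E P₀ P₁ Q₀) (S₄ E P₀ Q₀ Q₁) (+-monoˡ-≤ (P₀ * Q₀) (*-monoʳ-≤ E h))

module StandardWords where
  open Words
  open FractionArithmetic using (unimodular-step₁; unimodular-step₂)

  length-pow : ∀ u k → length (pow u k) ≡ k * length u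
  length-pow u zero    = refl
  length-pow u (suc k) = trans (length-++ u) (cong (length u +_) (length-pow u k))

  #b-pow : ∀ u k → #b (pow u k) ≡ k * #b u
  #b-pow u zero    = refl
  #b-pow u (suc k) = trans (#b-++ u (pow u k)) (cong (#b u +_) (#b-pow u k))

  pow-comm : ∀ u k → u ++ pow u k ≡ pow u k ++ u
  pow-comm u zero    = ++-identityʳ u
  pow-comm u (suc k) = trans (cong (u ++_) (pow-comm u k)) (sym (++-assoc u (pow u k) u))

  length-sw : ∀ f m → length (sw f (suc (suc m))) ≡ f (suc m) * length (sw f (suc m)) + length (sw f m)
  length-sw f m = trans (length-++ (pow (sw f (suc m)) (f (suc m))) {sw f m})
    (cong (_+ length (sw f m)) (length-pow (sw f (suc m)) (f (suc m))))

  #b-sw : ∀ f m → #b (sw f (suc (suc m))) ≡ f (suc m) * #b (sw f (suc m)) + #b (sw f m)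
  #b-sw f m = trans (#b-++ (pow (sw f (suc m)) (f (suc m))) (sw f m))
    (cong (_+ #b (sw f m)) (#b-pow (sw f (suc m)) (f (suc m))))

  sw-ext : ∀ {f g} → (∀ i → 1 ≤ i → f i ≡ g i) → ∀ m → sw f m ≡ sw g m
  sw-ext h zero          = refl
  sw-ext h (suc zero)    = refl
  sw-ext h (suc (suc m)) = cong₂ _++_ (cong₂ pow (sw-ext h (suc m)) (h (suc m) (s≤s z≤n))) (sw-ext h m)

  record AlmostCommute (u v : Word) : Set where
    field
      common : Word
      x y    : Letter
      x≢y    : x ≢ y
      uv≡    : u ++ v ≡ common ++ x ∷ y ∷ []
      vu≡    : v ++ u ≡ common ++ y ∷ x ∷ []

  almostCommute-length : ∀ {u v} (ac : AlmostCommute u v) → length u + length v ≡ length (AlmostCommute.common ac) + 2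
  almostCommute-length {u} {v} ac = trans (sym (length-++ u {v})) (trans (cong length uv≡) (length-++ common {x ∷ y ∷ []}))
    where open AlmostCommute ac

  almostCommute : ∀ f m → AlmostCommute (sw f (suc m)) (sw f m)
  almostCommute f zero    = record { common = [] ; x = a ; y = b ; x≢y = λ () ; uv≡ = refl ; vu≡ = refl }
  almostCommute f (suc m) = record
    { common = pow X k ++ common ; x = y ; y = x ; x≢y = λ e → x≢y (sym e)
    ; uv≡ = begin
        (pow X k ++ Y) ++ X    ≡⟨ ++-assoc (pow X k) Y X ⟩
        pow X k ++ (Y ++ X)    ≡⟨ cong (pow X k ++_) vu≡ ⟩
        pow X k ++ (common ++ y ∷ x ∷ []) ≡⟨ sym (++-assoc (pow X k) common _) ⟩
        (pow X k ++ common) ++ y ∷ x ∷ [] ∎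
    ; vu≡ = begin
        X ++ (pow X k ++ Y)    ≡⟨ sym (++-assoc X (pow X k) Y) ⟩
        (X ++ pow X k) ++ Y    ≡⟨ cong (_++ Y) (pow-comm X k) ⟩
        (pow X k ++ X) ++ Y    ≡⟨ ++-assoc (pow X k) X Y ⟩
        pow X k ++ (X ++ Y)    ≡⟨ cong (pow X k ++_) uv≡ ⟩
        pow X k ++ (common ++ x ∷ y ∷ []) ≡⟨ sym (++-assoc (pow X k) common _) ⟩
        (pow X k ++ common) ++ x ∷ y ∷ [] ∎ }
    where
    open ≡-Reasoning
    X = sw f (suc m)
    Y = sw f m
    k = f (suc m)
    open AlmostCommute (almostCommute f m)

  -- The exponents f 2, f 3, … are positive (f 1 may vanish); then
  -- s_0 ⊑ s_1 ⊑ s_2 ⊑ … and the standard words converge.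
  Admissible : (ℕ → ℕ) → Set
  Admissible f = ∀ i → 2 ≤ i → 1 ≤ f i

  ⊑-step : ∀ f m → 1 ≤ f (suc m) → sw f (suc m) ⊑ sw f (suc (suc m))
  ⊑-step f m p with f (suc m)
  ... | suc k = pow (sw f (suc m)) k ++ sw f m , ++-assoc (sw f (suc m)) (pow (sw f (suc m)) k) (sw f m)

  ⊑-chain : ∀ f → Admissible f → ∀ m j → sw f (suc (suc m)) ⊑ sw f (suc (suc (j + m)))
  ⊑-chain f adm m zero    = ⊑-refl _
  ⊑-chain f adm m (suc j) =
    ⊑-trans (⊑-chain f adm m j) (⊑-step f (suc (j + m)) (adm (suc (suc (j + m))) (s≤s (s≤s z≤n))))

  ⊑-XY : ∀ f m → 1 ≤ f (suc m) → 1 ≤ f (2 + m) → sw f (2 + m) ++ sw f (suc m) ⊑ sw f (3 + m)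
  ⊑-XY f m Y⊑X-pos k-pos = XY⊑X^kY (f (2 + m)) k-pos
    where
    X = sw f (2 + m)
    Y = sw f (suc m)
    Y⊑X^kY : ∀ k → Y ⊑ pow X k ++ Y
    Y⊑X^kY zero    = ⊑-refl Y
    Y⊑X^kY (suc k) = subst (Y ⊑_) (sym (++-assoc X (pow X k) Y)) (⊑-trans (⊑-step f m Y⊑X-pos) (⊑-++ X (pow X k ++ Y)))
    XY⊑X^kY : ∀ k → 1 ≤ k → X ++ Y ⊑ pow X k ++ Y
    XY⊑X^kY (suc k) _ = subst (X ++ Y ⊑_) (sym (++-assoc X (pow X k) Y)) (⊑-cong X (Y⊑X^kY k))

  length-pos : ∀ f m → 1 ≤ length (sw f m)
  length-pos f zero          = s≤s z≤n
  length-pos f (suc zero)    = s≤s z≤n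
  length-pos f (suc (suc m)) = ≤-trans (length-pos f m) (subst (length (sw f m) ≤_) (sym (length-sw f m)) (m≤n+m _ _))

  private
    length-step : ∀ X Y k → 1 ≤ k → length X + length Y ≤ length (pow X k ++ Y)
    length-step X Y (suc k) _ =
      subst (length X + length Y ≤_) (sym (trans (length-++ (X ++ pow X k) {Y}) (cong (_+ length Y) (length-++ X {pow X k}))))
        (+-monoˡ-≤ (length Y) (m≤m+n (length X) (length (pow X k))))

  -- |s_{m+1}| > m, so the limit is determined letter by letter.
  length-grows : ∀ f → Admissible f → ∀ m → suc m ≤ length (sw f (suc (suc m)))
  length-grows f adm zero = length-pos f 2
  length-grows f adm (suc zero) =
    ≤-trans (+-mono-≤ (length-pos f 2) (length-pos f 1)) (length-step (sw f 2) (sw f 1) (f 2) (adm 2 (s≤s (s≤s z≤n))))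
  length-grows f adm (suc (suc m)) =
    ≤-trans (≤-trans (s≤s (s≤s (m≤n+m (suc m) m))) (+-mono-≤ (length-grows f adm (suc m)) (length-grows f adm m)))
      (length-step (sw f (3 + m)) (sw f (2 + m)) (f (3 + m)) (adm (3 + m) (s≤s (s≤s z≤n))))

  -- The limit of the standard words (for f = d this is cα d, definitionally).
  limit : (ℕ → ℕ) → ℕ → Letter
  limit f t = sw f (suc (suc t)) ! t

  limit-agree : ∀ f → Admissible f → ∀ M i → i < length (sw f (suc (suc M))) → sw f (suc (suc M)) ! i ≡ limit f i
  limit-agree f adm M i i< = trans (⊑-! (⊑-chain f adm M i) i i<) (sym (⊑-! late i (length-grows f adm i)))
    where
    late : sw f (suc (suc i)) ⊑ sw f (suc (suc (i + M)))
    late = subst (λ z → sw f (suc (suc i)) ⊑ sw f (suc (suc z))) (+-comm M i) (⊑-chain f adm i M)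

  limit-ext : ∀ {f g} → (∀ i → 1 ≤ i → f i ≡ g i) → ∀ t → limit f t ≡ limit g t
  limit-ext h t = cong (_! t) (sw-ext h (suc (suc t)))

  limit-starts-with-a : ∀ f → Admissible f → ∀ i → i < f 1 → limit f i ≡ a
  limit-starts-with-a f adm i i<f1 = trans (sym (limit-agree f adm 0 i i<s₁)) (a^k-b i (f 1) i<f1)
    where
    a^k-b : ∀ i k → i < k → (pow (a ∷ []) k ++ b ∷ []) ! i ≡ a
    a^k-b zero    (suc k) _       = refl
    a^k-b (suc i) (suc k) (s≤s p) = a^k-b i k p
    i<s₁ : i < length (sw f 2)
    i<s₁ = subst (i <_) (sym (trans (length-sw f 0) (cong (_+ 1) (*-identityʳ (f 1)))))
             (≤-trans i<f1 (m≤m+n _ 1))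

  -- The limit has period |s_M| on its prefix of length |s_{M+1}| - 2 (M ≥ 1):
  -- s_{M+1} s_M ⊑ limit, and s_{M+1} s_M agrees with s_M s_{M+1} up to the last two letters.
  limit-periodic : ∀ f → Admissible f → ∀ M i → i + 2 < length (sw f (3 + M)) →
    limit f (length (sw f (2 + M)) + i) ≡ limit f i
  limit-periodic f adm M i i+2<X = begin
    limit f j                ≡⟨ sym (limit-agree f adm (suc (suc M)) j j<Z) ⟩
    Z ! j                    ≡⟨ sym (⊑-! XY⊑Z j j<XY) ⟩
    (X ++ Y) ! j             ≡⟨ cong (_! j) uv≡ ⟩
    (common ++ x ∷ y ∷ []) ! j ≡⟨ !-++ˡ common _ j j<common ⟩
    common ! j               ≡⟨ sym (!-++ˡ common (y ∷ x ∷ []) j j<common) ⟩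
    (common ++ y ∷ x ∷ []) ! j ≡⟨ cong (_! j) (sym vu≡) ⟩
    (Y ++ X) ! j             ≡⟨ !-++ʳ Y X i ⟩
    X ! i                    ≡⟨ limit-agree f adm (suc M) i (≤-trans (m≤m+n (suc i) 2) i+2<X) ⟩
    limit f i                ∎
    where
    open ≡-Reasoning
    X = sw f (3 + M)
    Y = sw f (2 + M)
    Z = sw f (4 + M)
    open AlmostCommute (almostCommute f (2 + M))
    j = length Y + i
    XY⊑Z : X ++ Y ⊑ Z
    XY⊑Z = ⊑-XY f (suc M) (adm (2 + M) (s≤s (s≤s z≤n))) (adm (3 + M) (s≤s (s≤s z≤n)))
    |XY| : length X + length Y ≡ length common + 2
    |XY| = almostCommute-length (almostCommute f (2 + M))
    j<common : j < length common
    j<common = +-cancelʳ-< 2 j (length common) (subst (j + 2 <_) |XY|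
      (subst (_< length X + length Y) (sym (+-assoc (length Y) i 2))
        (subst (length Y + (i + 2) <_) (+-comm (length Y) (length X)) (+-monoʳ-< (length Y) i+2<X))))
    j<XY : j < length (X ++ Y)
    j<XY = subst (j <_) (sym (trans (length-++ X {Y}) |XY|)) (≤-trans j<common (m≤m+n (length common) 2))
    j<Z : j < length Z
    j<Z = ≤-trans j<XY (⊑-length XY⊑Z)

  -- |v|_b |u| - |u|_b |v| = ±1; for u = s_m, v = s_{m-1} this is the
  -- classical determinant identity, which makes s_m primitive.
  Unimodular : Word → Word → Set
  Unimodular u v = (#b v * length u ≡ #b u * length v + 1) ⊎ (#b u * length v ≡ #b v * length u + 1)

  unimodular : ∀ f m → Unimodular (sw f (suc m)) (sw f m)
  unimodular f zero = inj₁ refl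
  unimodular f (suc m) with unimodular f m
  ... | inj₁ h = inj₂ (subst₂ (λ B L → B * length (sw f (suc m)) ≡ #b (sw f (suc m)) * L + 1)
                        (sym (#b-sw f m)) (sym (length-sw f m))
                        (unimodular-step₁ (f (suc m)) _ _ _ _ h))
  ... | inj₂ h = inj₁ (subst₂ (λ B L → #b (sw f (suc m)) * L ≡ B * length (sw f (suc m)) + 1)
                        (sym (#b-sw f m)) (sym (length-sw f m))
                        (unimodular-step₂ (f (suc m)) _ _ _ _ h))

-- The characteristic word c_γ of γ = [0; e 1, e 2, …] is the limit of the
-- standard words with exponents e 1 - 1, e 2, e 3, …  The proof identifies
-- the number of b's among the first m letters of the limit with ⌊(m+1)γ⌋:
-- |s_N| = q_N and |s_N|_b = p_N, and the floor of (m+1) p_N/q_N is carried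
-- from one convergent to the next (Floor⇒Ceil, Ceil⇒Floor) and along the
-- period q_N of the limit (limit-periodic).
module CharacteristicWords where
  open Words
  open StandardWords
  open FractionArithmetic

  isB : Letter → ℕ
  isB a = 0
  isB b = 1

  #b-∷ : ∀ x w → #b (x ∷ w) ≡ isB x + #b w
  #b-∷ a w = refl
  #b-∷ b w = refl

  #b< : (ℕ → Letter) → ℕ → ℕ
  #b< T zero    = 0
  #b< T (suc m) = #b< T m + isB (T m)

  #b<-ext : ∀ T U m → (∀ i → i < m → T i ≡ U i) → #b< T m ≡ #b< U m
  #b<-ext T U zero    h = refl
  #b<-ext T U (suc m) h = cong₂ _+_ (#b<-ext T U m (λ i i<m → h i (≤-trans i<m (n≤1+n m)))) (cong isB (h m ≤-refl))

  #b<-+ : ∀ T p m → #b< T (p + m) ≡ #b< T p + #b< (λ i → T (p + i)) m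
  #b<-+ T p zero    = trans (cong (#b< T) (+-identityʳ p)) (sym (+-identityʳ _))
  #b<-+ T p (suc m) = trans (cong (#b< T) (+-suc p m))
    (trans (cong (_+ isB (T (p + m))) (#b<-+ T p m)) (+-assoc (#b< T p) _ _))

  #b<-word : ∀ T w → OccursIn T 0 w → #b< T (length w) ≡ #b w
  #b<-word T []      h = refl
  #b<-word T (x ∷ w) h = trans (#b<-+ T 1 (length w))
    (trans (cong₂ _+_ (cong isB (h 0 (s≤s z≤n))) (#b<-word (λ i → T (suc i)) w (λ i p → h (suc i) (s≤s p))))
      (sym (#b-∷ x w)))

  -- Extending a property G₁ (x, B(x-1)) from 1 ≤ x < Q₀ + Q₁ to 1 ≤ x < Q₁ + Q₂:
  -- on the initial range it follows from G₀, beyond it from the shift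
  -- invariance of G₁ and the quasi-periodicity B(Q₁ + m) = P₁ + B(m).
  propagate : ∀ (B : ℕ → ℕ) (P₁ Q₀ Q₁ Q₂ : ℕ) (G₀ G₁ : ℕ → ℕ → Set)
    → (∀ x j → 1 ≤ x → x < Q₀ + Q₁ → G₀ x j → G₁ x j)
    → (∀ x j → G₁ x j → G₁ (Q₁ + x) (P₁ + j))
    → (∀ m → suc m < Q₀ + Q₁ → G₀ (suc m) (B m))
    → (∀ m → suc m < Q₂ → B (Q₁ + m) ≡ P₁ + B m)
    → 1 ≤ Q₀ → 1 ≤ Q₁
    → ∀ m → suc m < Q₁ + Q₂ → G₁ (suc m) (B m)
  propagate B P₁ Q₀ Q₁ Q₂ G₀ G₁ transfer shift initial period 1≤Q₀ 1≤Q₁ m m< = go (suc m) m ≤-refl m<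
    where
    go : ∀ n m → m < n → suc m < Q₁ + Q₂ → G₁ (suc m) (B m)
    go (suc n) m (s≤s m≤n) m< with suc m <? Q₀ + Q₁
    ... | yes small = transfer (suc m) (B m) (s≤s z≤n) small (initial m small)
    ... | no  large =
      subst₂ G₁ (trans (+-suc Q₁ m') (cong suc Q₁+m'≡m)) (trans (sym (period m' m'<)) (cong B Q₁+m'≡m))
        (shift (suc m') (B m') (go n m' m'<n (≤-trans m'< (m≤n+m Q₂ Q₁))))
      where
      Q₁≤m : Q₁ ≤ m
      Q₁≤m = ≤-pred (≤-trans (+-monoˡ-≤ Q₁ 1≤Q₀) (≮⇒≥ large))
      m' = proj₁ (m≤n⇒∃[o]m+o≡n Q₁≤m)
      Q₁+m'≡m : Q₁ + m' ≡ m
      Q₁+m'≡m = proj₂ (m≤n⇒∃[o]m+o≡n Q₁≤m)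
      m'< : suc m' < Q₂
      m'< = +-cancelˡ-< Q₁ (suc m') Q₂
              (subst (_< Q₁ + Q₂) (sym (+-suc Q₁ m')) (subst (λ z → suc z < Q₁ + Q₂) (sym Q₁+m'≡m) m<))
      m'<n : m' < n
      m'<n = ≤-trans (subst (suc m' ≤_) Q₁+m'≡m (+-monoˡ-≤ m' 1≤Q₁)) m≤n

  PartialQuotients : (ℕ → ℕ) → Set
  PartialQuotients e = ∀ i → 1 ≤ i → 1 ≤ e i

  exponents : (ℕ → ℕ) → ℕ → ℕ
  exponents e zero          = 0
  exponents e (suc zero)    = e 1 ∸ 1
  exponents e (suc (suc i)) = e (suc (suc i))

  exponents-admissible : ∀ e → PartialQuotients e → Admissible (exponents e)
  exponents-admissible e pq (suc (suc i)) _       = pq (suc (suc i)) (s≤s z≤n)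
  exponents-admissible e pq (suc zero)    (s≤s ())

  twice : ℕ → ℕ
  twice zero    = 0
  twice (suc k) = suc (suc (twice k))

  twice≡2* : ∀ k → twice k ≡ 2 * k
  twice≡2* zero    = refl
  twice≡2* (suc k) = trans (cong (λ z → suc (suc z)) (twice≡2* k)) (sym (+-suc (suc k) (k + 0)))

  n≤twice : ∀ k → k ≤ twice k
  n≤twice zero    = z≤n
  n≤twice (suc k) = s≤s (≤-trans (n≤twice k) (n≤1+n _))

  module _ (e : ℕ → ℕ) (pq : PartialQuotients e) where
    private
      f : ℕ → ℕ
      f = exponents e
      adm : Admissible f
      adm = exponents-admissible e pq
      c : ℕ → Letter
      c = limit f
      P Q : ℕ → ℕ
      P = cfP e
      Q = cfQ e

    length≡q : ∀ N → length (sw f (suc N)) ≡ Q N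
    length≡q zero          = refl
    length≡q (suc zero)    = trans (length-sw f 0) (trans (cong (_+ 1) (*-identityʳ (e 1 ∸ 1))) (m∸n+n≡m (pq 1 (s≤s z≤n))))
    length≡q (suc (suc N)) = trans (length-sw f (suc N)) (cong₂ (λ u v → e (suc (suc N)) * u + v) (length≡q (suc N)) (length≡q N))

    #b≡p : ∀ N → #b (sw f (suc N)) ≡ P N
    #b≡p zero          = refl
    #b≡p (suc zero)    = trans (#b-sw f 0) (cong (_+ 1) (*-zeroʳ (e 1 ∸ 1)))
    #b≡p (suc (suc N)) = trans (#b-sw f (suc N)) (cong₂ (λ u v → e (suc (suc N)) * u + v) (#b≡p (suc N)) (#b≡p N))

    q-pos : ∀ N → 1 ≤ Q N
    q-pos N = subst (1 ≤_) (length≡q N) (length-pos f (suc N))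

    q-large : ∀ N → N ≤ Q N
    q-large zero    = z≤n
    q-large (suc N) = subst (suc N ≤_) (length≡q (suc N)) (length-grows f adm N)

    det-even : ∀ k → P (suc (twice k)) * Q (twice k) ≡ P (twice k) * Q (suc (twice k)) + 1
    det-odd  : ∀ k → P (suc (twice k)) * Q (suc (suc (twice k))) ≡ P (suc (suc (twice k))) * Q (suc (twice k)) + 1
    det-even zero    = refl
    det-even (suc k) = unimodular-step₁ (e (3 + twice k)) _ _ _ _ (det-odd k)
    det-odd  k       = unimodular-step₂ (e (2 + twice k)) _ _ _ _ (det-even k)

    #b<-period : ∀ N m → suc m < Q (2 + N) → #b< c (Q (suc N) + m) ≡ P (suc N) + #b< c m
    #b<-period N m m< = trans (#b<-+ c (Q (suc N)) m) (cong₂ _+_ prefix periodic)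
      where
      prefix : #b< c (Q (suc N)) ≡ P (suc N)
      prefix = trans (cong (#b< c) (sym (length≡q (suc N))))
        (trans (#b<-word c (sw f (2 + N)) (λ i i< → sym (limit-agree f adm N i i<))) (#b≡p (suc N)))
      periodic : #b< (λ i → c (Q (suc N) + i)) m ≡ #b< c m
      periodic = #b<-ext _ c m (λ i i<m → trans (cong (λ z → c (z + i)) (sym (length≡q (suc N))))
        (limit-periodic f adm N i (subst (i + 2 <_) (sym (length≡q (2 + N)))
          (≤-trans (subst (_≤ suc (suc m)) (cong suc (+-comm 2 i)) (s≤s (s≤s i<m))) m<))))

    #b<-initial : ∀ m → m ≤ f 1 → #b< c m ≡ 0
    #b<-initial zero    _ = refl
    #b<-initial (suc m) p = cong₂ _+_ (#b<-initial m (≤-trans (n≤1+n m) p)) (cong isB (limit-starts-with-a f adm m p))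

    floor-even : ∀ k m → suc m < Q (twice k) + Q (suc (twice k)) → Floor (P (twice k)) (Q (twice k)) (suc m) (#b< c m)
    ceil-odd   : ∀ k m → suc m < Q (suc (twice k)) + Q (2 + twice k) → Ceil (P (suc (twice k))) (Q (suc (twice k))) (suc m) (#b< c m)
    floor-even zero m m< = subst (Floor 0 1 (suc m)) (sym (#b<-initial m (∸-monoˡ-≤ 1 (≤-pred m<))))
      (z≤n , s≤s (≤-reflexive (*-zeroʳ m)))
    floor-even (suc k) = propagate (#b< c) (P (2 + twice k)) (Q (suc (twice k))) (Q (2 + twice k)) (Q (3 + twice k))
      (Ceil (P (suc (twice k))) (Q (suc (twice k)))) (Floor (P (2 + twice k)) (Q (2 + twice k)))
      (λ x j → Ceil⇒Floor _ _ _ _ x j (det-odd k)) (λ x j → Floor-shift _ _ x j) (ceil-odd k)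
      (#b<-period (suc (twice k))) (q-pos (suc (twice k))) (q-pos (2 + twice k))
    ceil-odd k = propagate (#b< c) (P (suc (twice k))) (Q (twice k)) (Q (suc (twice k))) (Q (2 + twice k))
      (Floor (P (twice k)) (Q (twice k))) (Ceil (P (suc (twice k))) (Q (suc (twice k))))
      (λ x j → Floor⇒Ceil _ _ _ _ x j (det-even k)) (λ x j → Ceil-shift _ _ x j) (floor-even k)
      (#b<-period (twice k)) (q-pos (twice k)) (q-pos (suc (twice k)))

    #b<-IsFloor : ∀ m → IsFloor e (suc m) (#b< c m)
    #b<-IsFloor m =
      (k , subst (λ z → #b< c m * cfQ e z ≤ cfP e z * suc m) (twice≡2* k)
             (subst (#b< c m * Q (twice k) ≤_) (*-comm (suc m) (P (twice k))) (proj₁ below))) ,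
      (k , subst (λ z → cfP e (suc z) * suc m ≤ suc (#b< c m) * cfQ e (suc z)) (twice≡2* k)
             (subst (_≤ suc (#b< c m) * Q (suc (twice k))) (*-comm (suc m) (P (suc (twice k)))) (proj₂ above)))
      where
      k = suc m
      <+pos : ∀ {s A B} → s ≤ A → 1 ≤ B → s < A + B
      <+pos {s} {A} {B} p q = ≤-trans (s≤s p) (subst (_≤ A + B) (+-comm A 1) (+-monoʳ-≤ A q))
      below : Floor (P (twice k)) (Q (twice k)) (suc m) (#b< c m)
      below = floor-even k m (<+pos (≤-trans (n≤twice k) (q-large (twice k))) (q-pos (suc (twice k))))
      above : Ceil (P (suc (twice k))) (Q (suc (twice k))) (suc m) (#b< c m)
      above = ceil-odd k m (<+pos (≤-trans (n≤twice k) (≤-trans (n≤1+n _) (q-large (suc (twice k))))) (q-pos (2 + twice k)))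

    even-increasing : ∀ k → P (twice k) * Q (twice (suc k)) ≤ P (twice (suc k)) * Q (twice k)
    even-increasing k = mediant-≥ (e (2 + twice k)) (P (twice k)) (P (suc (twice k))) (Q (twice k)) (Q (suc (twice k)))
      (subst (P (twice k) * Q (suc (twice k)) ≤_) (sym (det-even k)) (m≤m+n _ 1))

    odd-decreasing : ∀ k → P (suc (twice (suc k))) * Q (suc (twice k)) ≤ P (suc (twice k)) * Q (suc (twice (suc k)))
    odd-decreasing k = mediant-≤ (e (3 + twice k)) (P (suc (twice k))) (P (2 + twice k)) (Q (suc (twice k))) (Q (2 + twice k))
      (subst (P (2 + twice k) * Q (suc (twice k)) ≤_) (sym (det-odd k)) (m≤m+n _ 1))

    even-chain : ∀ k j → P (twice k) * Q (twice (j + k)) ≤ P (twice (j + k)) * Q (twice k)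
    even-chain k zero    = ≤-refl
    even-chain k (suc j) = frac-≤-≤ (P (twice k)) (Q (twice k)) (P (twice (j + k))) (Q (twice (j + k)))
      (P (twice (suc (j + k)))) (Q (twice (suc (j + k))))
      (q-pos (twice (j + k))) (even-chain k j) (even-increasing (j + k))

    odd-chain : ∀ k j → P (suc (twice (j + k))) * Q (suc (twice k)) ≤ P (suc (twice k)) * Q (suc (twice (j + k)))
    odd-chain k zero    = ≤-refl
    odd-chain k (suc j) = frac-≤-≤ (P (suc (twice (suc (j + k))))) (Q (suc (twice (suc (j + k)))))
      (P (suc (twice (j + k)))) (Q (suc (twice (j + k)))) (P (suc (twice k))) (Q (suc (twice k)))
      (q-pos (suc (twice (j + k)))) (odd-decreasing (j + k)) (odd-chain k j)

    even<odd : ∀ k₁ k₂ → P (twice k₁) * Q (suc (twice k₂)) < P (suc (twice k₂)) * Q (twice k₁)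
    even<odd k₁ k₂ = frac-<-≤ (P (twice k₁)) (Q (twice k₁)) (P (suc (twice K))) (Q (suc (twice K)))
      (P (suc (twice k₂))) (Q (suc (twice k₂))) (q-pos (suc (twice k₂)))
      (frac-≤-< (P (twice k₁)) (Q (twice k₁)) (P (twice K)) (Q (twice K)) (P (suc (twice K))) (Q (suc (twice K)))
        (q-pos (twice k₁)) (even-chain k₁ k₂) adjacent)
      (subst (λ z → P (suc (twice z)) * Q (suc (twice k₂)) ≤ P (suc (twice k₂)) * Q (suc (twice z))) (+-comm k₁ k₂) (odd-chain k₂ k₁))
      where
      K = k₂ + k₁
      adjacent : P (twice K) * Q (suc (twice K)) < P (suc (twice K)) * Q (twice K)
      adjacent = subst (P (twice K) * Q (suc (twice K)) <_) (sym (det-even K)) (≤-reflexive (+-comm 1 _))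

    IsFloor-≤ : ∀ x j j' → IsFloor e x j → IsFloor e x j' → j ≤ j'
    IsFloor-≤ x j j' ((k₁ , below) , _) (_ , (k₂ , above)) with j ≤? j'
    ... | yes j≤j' = j≤j'
    ... | no  j≰j' = ⊥-elim (<⇒≱ (even<odd k₁ k₂) (subst (_≤ Pₑ * Qₒ) (*-comm Qₑ Pₒ) (*-cancelˡ-≤ (suc j') chain)))
      where
      Pₑ = P (twice k₁)
      Qₑ = Q (twice k₁)
      Pₒ = P (suc (twice k₂))
      Qₒ = Q (suc (twice k₂))
      below' : suc j' * Qₑ ≤ Pₑ * x
      below' = ≤-trans (*-monoˡ-≤ Qₑ (≰⇒> j≰j')) (subst (λ z → j * cfQ e z ≤ cfP e z * x) (sym (twice≡2* k₁)) below)
      above' : Pₒ * x ≤ suc j' * Qₒ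
      above' = subst (λ z → cfP e (suc z) * x ≤ suc j' * cfQ e (suc z)) (sym (twice≡2* k₂)) above
      S₁ : ∀ c Qₑ Pₒ → c * (Qₑ * Pₒ) ≡ c * Qₑ * Pₒ
      S₁ = solve-∀
      S₂ : ∀ Pₑ x Pₒ → Pₑ * x * Pₒ ≡ Pₑ * (Pₒ * x)
      S₂ = solve-∀
      S₃ : ∀ Pₑ c Qₒ → Pₑ * (c * Qₒ) ≡ c * (Pₑ * Qₒ)
      S₃ = solve-∀
      chain : suc j' * (Qₑ * Pₒ) ≤ suc j' * (Pₑ * Qₒ)
      chain = begin
        suc j' * (Qₑ * Pₒ) ≡⟨ S₁ (suc j') Qₑ Pₒ ⟩
        suc j' * Qₑ * Pₒ   ≤⟨ *-monoˡ-≤ Pₒ below' ⟩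
        Pₑ * x * Pₒ        ≡⟨ S₂ Pₑ x Pₒ ⟩
        Pₑ * (Pₒ * x)      ≤⟨ *-monoʳ-≤ Pₑ above' ⟩
        Pₑ * (suc j' * Qₒ) ≡⟨ S₃ Pₑ (suc j') Qₒ ⟩
        suc j' * (Pₑ * Qₒ) ∎
        where open ≤-Reasoning

    IsFloor-unique : ∀ x j j' → IsFloor e x j → IsFloor e x j' → j ≡ j'
    IsFloor-unique x j j' h h' = ≤-antisym (IsFloor-≤ x j j' h h') (IsFloor-≤ x j' j h' h)

    CharLetter⇒limit : ∀ t y → CharLetter e t y → y ≡ c t
    CharLetter⇒limit t a (j , ⌊t+2⌋ , ⌊t+1⌋) = sameFloor (c t) refl
      where
      j≡next : j ≡ #b< c t + isB (c t)
      j≡next = IsFloor-unique _ _ _ (subst (λ z → IsFloor e z j) (+-comm t 2) ⌊t+2⌋) (#b<-IsFloor (suc t))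
      j≡this : j ≡ #b< c t
      j≡this = IsFloor-unique _ _ _ (subst (λ z → IsFloor e z j) (+-comm t 1) ⌊t+1⌋) (#b<-IsFloor t)
      sameFloor : ∀ y → y ≡ c t → a ≡ c t
      sameFloor a eq = eq
      sameFloor b eq = ⊥-elim (m+1+n≢m (#b< c t) {0}
        (trans (cong (λ z → #b< c t + isB z) eq) (trans (sym j≡next) j≡this)))
    CharLetter⇒limit t b (j , j' , ⌊t+2⌋ , ⌊t+1⌋ , j≢j') = differentFloors (c t) refl
      where
      j≡next : j ≡ #b< c t + isB (c t)
      j≡next = IsFloor-unique _ _ _ (subst (λ z → IsFloor e z j) (+-comm t 2) ⌊t+2⌋) (#b<-IsFloor (suc t))
      j'≡this : j' ≡ #b< c t
      j'≡this = IsFloor-unique _ _ _ (subst (λ z → IsFloor e z j') (+-comm t 1) ⌊t+1⌋) (#b<-IsFloor t)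
      differentFloors : ∀ y → y ≡ c t → b ≡ c t
      differentFloors b eq = eq
      differentFloors a eq = ⊥-elim (j≢j' (trans j≡next
        (trans (cong (λ z → #b< c t + isB z) (sym eq)) (trans (+-identityʳ _) (sym j'≡this)))))

-- A word X with |X| and |X|_b coprime (witnessed by a unimodular partner Y)
-- is primitive: its conjugates C_0 X, …, C_{|X|-1} X are pairwise distinct.
module Conjugates where
  open Words
  open StandardWords using (Unimodular)
  open FractionArithmetic using (*-swapʳ)

  commuting-proportional : ∀ n u v → length u + length v ≤ n → u ++ v ≡ v ++ u → #b u * length v ≡ #b v * length u

  -- The case |u| ≤ |v|: then v = u v' with u v' = v' u.
  private
    shorter-first : ∀ n u v → length u + length v ≤ n → length u ≤ length v → u ++ v ≡ v ++ u →
      #b u * length v ≡ #b v * length u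
    shorter-first n       []      v _     _   _     = sym (*-zeroʳ (#b v))
    shorter-first (suc n) (x ∷ u) v small u≤v uv≡vu = begin
      #b U * length v                       ≡⟨ cong (#b U *_) |v| ⟩
      #b U * (length U + length v')         ≡⟨ *-distribˡ-+ (#b U) (length U) (length v') ⟩
      #b U * length U + #b U * length v'    ≡⟨ cong (#b U * length U +_) ih ⟩
      #b U * length U + #b v' * length U    ≡⟨ sym (*-distribʳ-+ (length U) (#b U) (#b v')) ⟩
      (#b U + #b v') * length U             ≡⟨ cong (_* length U) (sym (trans (cong #b v≡) (#b-++ U v'))) ⟩
      #b v * length U                       ∎
      where
      open ≡-Reasoning
      U = x ∷ u
      U⊑v : U ⊑ v
      U⊑v = ⊑-by-length U v (v ++ U) (v , sym uv≡vu) (U , refl) u≤v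
      v' = proj₁ U⊑v
      v≡ : v ≡ U ++ v'
      v≡ = proj₂ U⊑v
      Uv'≡v'U : U ++ v' ≡ v' ++ U
      Uv'≡v'U = ++-cancelˡ U (U ++ v') (v' ++ U)
        (trans (cong (U ++_) (sym v≡)) (trans uv≡vu (trans (cong (_++ U) v≡) (++-assoc U v' U))))
      |v| : length v ≡ length U + length v'
      |v| = trans (cong length v≡) (length-++ U)
      smaller : length U + length v' ≤ n
      smaller = ≤-trans (m≤n+m (length U + length v') (length u)) (≤-pred (subst (λ z → length U + z ≤ suc n) |v| small))
      ih : #b U * length v' ≡ #b v' * length U
      ih = commuting-proportional n U v' smaller Uv'≡v'U

  commuting-proportional n u v small uv≡vu with length u ≤? length v
  ... | yes u≤v = shorter-first n u v small u≤v uv≡vu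
  ... | no  u≰v = sym (shorter-first n v u (subst (_≤ n) (+-comm (length u) (length v)) small) (<⇒≤ (≰⇒> u≰v)) (sym uv≡vu))

  no-multiple-gap : ∀ m m' Q δ → m * Q ≡ m' * Q + δ → 0 < δ → δ < Q → ⊥
  no-multiple-gap m m' Q δ eq δ>0 δ<Q with m ≤? m'
  ... | yes m≤m' = <⇒≱ (subst (m' * Q <_) (sym eq) (m<m+n (m' * Q) δ>0)) (*-monoˡ-≤ Q m≤m')
  ... | no  m≰m' = <⇒≱ (+-monoʳ-< (m' * Q) δ<Q) (subst₂ _≤_ (+-comm Q (m' * Q)) eq (*-monoˡ-≤ Q (≰⇒> m≰m')))

  -- A coincidence C_r X = C_{r+δ} X exhibits X as a conjugate of a word D V
  -- with |D| = δ and D V = V D (write X = A D E and take V = E A).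
  record CommutingSplit (X : Word) (δ : ℕ) : Set where
    field
      D V      : Word
      |D|      : length D ≡ δ
      commutes : D ++ V ≡ V ++ D
      |X|      : length X ≡ length D + length V
      #bX      : #b X ≡ #b D + #b V

  coincidence⇒split : ∀ X r δ → r + δ ≤ length X → C r X ≡ C (r + δ) X → CommutingSplit X δ
  coincidence⇒split X r δ r+δ≤X Cr≡Cr+δ = record
    { D = D ; V = E ++ A ; |D| = |D| ; commutes = D-commutes
    ; |X| = trans (conjugate-invariant length length-comm) (length-++ D)
    ; #bX = trans (conjugate-invariant #b #b-comm) (#b-++ D (E ++ A)) }
    where
    split₁ = splitAt X r (≤-trans (m≤m+n r δ) r+δ≤X)
    A = proj₁ split₁
    W = proj₁ (proj₂ split₁)
    X≡AW : X ≡ A ++ W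
    X≡AW = proj₁ (proj₂ (proj₂ split₁))
    |A| : length A ≡ r
    |A| = proj₂ (proj₂ (proj₂ split₁))
    split₂ = splitAt W δ (+-cancelˡ-≤ r δ (length W)
      (subst (r + δ ≤_) (trans (cong length X≡AW) (trans (length-++ A) (cong (_+ length W) |A|))) r+δ≤X))
    D = proj₁ split₂
    E = proj₁ (proj₂ split₂)
    W≡DE : W ≡ D ++ E
    W≡DE = proj₁ (proj₂ (proj₂ split₂))
    |D| : length D ≡ δ
    |D| = proj₂ (proj₂ (proj₂ split₂))
    X≡ADE : X ≡ (A ++ D) ++ E
    X≡ADE = trans X≡AW (trans (cong (A ++_) W≡DE) (sym (++-assoc A D E)))
    D-commutes : D ++ (E ++ A) ≡ (E ++ A) ++ D
    D-commutes = begin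
      D ++ (E ++ A)                       ≡⟨ sym (++-assoc D E A) ⟩
      (D ++ E) ++ A                       ≡⟨ cong (_++ A) (sym W≡DE) ⟩
      W ++ A                              ≡⟨ sym (C-++ A W) ⟩
      C (length A) (A ++ W)               ≡⟨ cong₂ C |A| (sym X≡AW) ⟩
      C r X                               ≡⟨ Cr≡Cr+δ ⟩
      C (r + δ) X                         ≡⟨ cong₂ C (sym (trans (length-++ A) (cong₂ _+_ |A| |D|))) X≡ADE ⟩
      C (length (A ++ D)) ((A ++ D) ++ E) ≡⟨ C-++ (A ++ D) E ⟩
      E ++ (A ++ D)                       ≡⟨ sym (++-assoc E A D) ⟩
      (E ++ A) ++ D                       ∎
      where open ≡-Reasoning
    conjugate-invariant : (g : Word → ℕ) → (∀ u v → g (u ++ v) ≡ g (v ++ u)) → g X ≡ g (D ++ (E ++ A))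
    conjugate-invariant g g-comm = trans (cong g X≡ADE) (trans (cong g (++-assoc A D E))
      (trans (g-comm A (D ++ E)) (cong g (++-assoc D E A))))

  split-density : ∀ X δ (S : CommutingSplit X δ) → #b (CommutingSplit.D S) * length X ≡ #b X * δ
  split-density X δ S = begin
    #b D * length X                       ≡⟨ cong (#b D *_) |X| ⟩
    #b D * (length D + length V)          ≡⟨ *-distribˡ-+ (#b D) (length D) (length V) ⟩
    #b D * length D + #b D * length V     ≡⟨ cong (#b D * length D +_) (commuting-proportional _ D V ≤-refl commutes) ⟩
    #b D * length D + #b V * length D     ≡⟨ sym (*-distribʳ-+ (length D) (#b D) (#b V)) ⟩
    (#b D + #b V) * length D              ≡⟨ cong₂ _*_ (sym #bX) |D| ⟩
    #b X * δ                              ∎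
    where
    open ≡-Reasoning
    open CommutingSplit S

  unimodular-indivisible : ∀ X Y → Unimodular X Y → ∀ m δ → 1 ≤ δ → δ < length X → m * length X ≢ #b X * δ
  unimodular-indivisible X Y (inj₁ h) m δ δ≥1 δ<Q m*Q≡ = no-multiple-gap (δ * #b Y) (m * length Y) (length X) δ (begin
    δ * #b Y * length X                ≡⟨ *-assoc δ (#b Y) (length X) ⟩
    δ * (#b Y * length X)              ≡⟨ cong (δ *_) h ⟩
    δ * (#b X * length Y + 1)          ≡⟨ S₁ δ (#b X) (length Y) ⟩
    #b X * δ * length Y + δ            ≡⟨ cong (λ z → z * length Y + δ) (sym m*Q≡) ⟩
    m * length X * length Y + δ        ≡⟨ cong (_+ δ) (*-swapʳ m (length X) (length Y)) ⟩
    m * length Y * length X + δ        ∎) δ≥1 δ<Q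
    where
    open ≡-Reasoning
    S₁ : ∀ δ cX RY → δ * (cX * RY + 1) ≡ cX * δ * RY + δ
    S₁ = solve-∀
  unimodular-indivisible X Y (inj₂ h) m δ δ≥1 δ<Q m*Q≡ = no-multiple-gap (m * length Y) (δ * #b Y) (length X) δ (begin
    m * length Y * length X            ≡⟨ *-swapʳ m (length Y) (length X) ⟩
    m * length X * length Y            ≡⟨ cong (_* length Y) m*Q≡ ⟩
    #b X * δ * length Y                ≡⟨ S₂ (#b X) δ (length Y) ⟩
    δ * (#b X * length Y)              ≡⟨ cong (δ *_) h ⟩
    δ * (#b Y * length X + 1)          ≡⟨ S₃ δ (#b Y) (length X) ⟩
    δ * #b Y * length X + δ            ∎) δ≥1 δ<Q
    where
    open ≡-Reasoning
    S₂ : ∀ cX δ RY → cX * δ * RY ≡ δ * (cX * RY)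
    S₂ = solve-∀
    S₃ : ∀ δ BY Q → δ * (BY * Q + 1) ≡ δ * BY * Q + δ
    S₃ = solve-∀

  conjugates-distinct-δ : ∀ X Y → Unimodular X Y → ∀ r δ → 1 ≤ δ → r + δ < length X → C r X ≢ C (r + δ) X
  conjugates-distinct-δ X Y unimod r δ δ≥1 r+δ<X Cr≡Cr+δ =
    unimodular-indivisible X Y unimod (#b (CommutingSplit.D S)) δ δ≥1 (≤-trans (s≤s (m≤n+m δ r)) r+δ<X) (split-density X δ S)
    where
    S : CommutingSplit X δ
    S = coincidence⇒split X r δ (<⇒≤ r+δ<X) Cr≡Cr+δ

  conjugates-distinct : ∀ X Y → Unimodular X Y → ∀ r k → r < length X → k < length X → C r X ≡ C k X → r ≡ k
  conjugates-distinct X Y unimod r k r<X k<X Cr≡Ck with <-cmp r k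
  ... | tri≈ _ r≡k _ = r≡k
  ... | tri< r<k _ _ = ⊥-elim (conjugates-distinct-δ X Y unimod r (k ∸ r) (m<n⇒0<n∸m r<k)
          (subst (_< length X) (sym (m+[n∸m]≡n (<⇒≤ r<k))) k<X) (trans Cr≡Ck (cong (λ z → C z X) (sym (m+[n∸m]≡n (<⇒≤ r<k))))))
  ... | tri> _ _ k<r = ⊥-elim (conjugates-distinct-δ X Y unimod k (r ∸ k) (m<n⇒0<n∸m k<r)
          (subst (_< length X) (sym (m+[n∸m]≡n (<⇒≤ k<r))) r<X) (trans (sym Cr≡Ck) (cong (λ z → C z X) (sym (m+[n∸m]≡n (<⇒≤ k<r))))))

module Substitutions where
  open Words

  module Substitution (μ : Letter → Word) where

    image : Word → Word
    image []      = []
    image (x ∷ v) = μ x ++ image v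

    image-++ : ∀ u v → image (u ++ v) ≡ image u ++ image v
    image-++ []      v = refl
    image-++ (x ∷ u) v = trans (cong (μ x ++_) (image-++ u v)) (sym (++-assoc (μ x) (image u) (image v)))

    image-pow : ∀ u k → image (pow u k) ≡ pow (image u) k
    image-pow u zero    = refl
    image-pow u (suc k) = trans (image-++ u (pow u k)) (cong (image u ++_) (image-pow u k))

    blockStart : (ℕ → Letter) → ℕ → ℕ
    blockStart U zero    = 0
    blockStart U (suc J) = blockStart U J + length (μ (U J))

    blockStart-suc : ∀ U J → blockStart U (suc J) ≡ length (μ (U 0)) + blockStart (U ∘ suc) J
    blockStart-suc U zero    = +-comm 0 _
    blockStart-suc U (suc J) = trans (cong (_+ length (μ (U (suc J)))) (blockStart-suc U J)) (+-assoc (length (μ (U 0))) _ _)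

    block-occurs : ∀ v U T → OccursIn U 0 v → OccursIn T 0 (image v) →
      ∀ J → J < length v → OccursIn T (blockStart U J) (μ (U J))
    block-occurs (x ∷ v) U T hU hT zero _ i i< =
      trans (hT i i<image) (trans (!-++ˡ (μ x) (image v) i i<μx) (cong (λ z → μ z ! i) (sym U0≡x)))
      where
      U0≡x : U 0 ≡ x
      U0≡x = hU 0 (s≤s z≤n)
      i<μx : i < length (μ x)
      i<μx = subst (λ z → i < length (μ z)) U0≡x i<
      i<image : i < length (image (x ∷ v))
      i<image = subst (i <_) (sym (length-++ (μ x) {image v})) (≤-trans i<μx (m≤m+n _ _))
    block-occurs (x ∷ v) U T hU hT (suc J) (s≤s J<v) =
      subst (λ z → OccursIn T z (μ (U (suc J))))
        (sym (trans (blockStart-suc U J) (cong (λ z → length (μ z) + blockStart (U ∘ suc) J) (hU 0 (s≤s z≤n)))))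
        (unshift {length (μ x)} {blockStart (U ∘ suc) J} {μ (U (suc J))} (block-occurs v (U ∘ suc) (λ i → T (length (μ x) + i)) (λ i p → hU (suc i) (s≤s p))
          (λ i p → trans (hT (length (μ x) + i) (subst (length (μ x) + i <_) (sym (length-++ (μ x) {image v})) (+-monoʳ-< _ p)))
                         (!-++ʳ (μ x) (image v) i))
          J J<v))
      where
      unshift : ∀ {p q w} → OccursIn (λ i → T (p + i)) q w → OccursIn T (p + q) w
      unshift {p} {q} h i i< = trans (cong T (+-assoc p q i)) (h i i<)

  τ : Letter → Word
  τ a = a ∷ []
  τ b = a ∷ b ∷ []

  τ-image : Word → Word
  τ-image = Substitution.image τ

  τ-image-++ : ∀ u v → τ-image (u ++ v) ≡ τ-image u ++ τ-image v
  τ-image-++ = Substitution.image-++ τ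

  τ-image-pow : ∀ u k → τ-image (pow u k) ≡ pow (τ-image u) k
  τ-image-pow = Substitution.image-pow τ

  isA : Letter → ℕ
  isA a = 1
  isA b = 0

  #a< : (ℕ → Letter) → ℕ → ℕ
  #a< U zero    = 0
  #a< U (suc J) = #a< U J + isA (U J)

  #a<-suc : ∀ U J → #a< U (suc J) ≡ isA (U 0) + #a< (U ∘ suc) J
  #a<-suc U zero    = +-comm 0 _
  #a<-suc U (suc J) = trans (cong (_+ isA (U (suc J))) (#a<-suc U J)) (+-assoc (isA (U 0)) _ _)

  #a<-≤ : ∀ U J → #a< U J ≤ J
  #a<-≤ U zero    = z≤n
  #a<-≤ U (suc J) = subst (_≤ suc J) (+-comm (isA (U J)) (#a< U J)) (+-mono-≤ (isA≤1 (U J)) (#a<-≤ U J))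
    where
    isA≤1 : ∀ x → isA x ≤ 1
    isA≤1 a = s≤s z≤n
    isA≤1 b = z≤n

  private
    τ-image-starts-with-a : ∀ v → 0 < length (τ-image v) → τ-image v ! 0 ≡ a
    τ-image-starts-with-a (a ∷ v) _ = refl
    τ-image-starts-with-a (b ∷ v) _ = refl

  -- In a word U beginning with τ(v), the letter after the (#a< U J)-th a of U
  -- is the letter v(#a< U J): each a of U starts a block τ(x).
  τ-next : ∀ v U → OccursIn U 0 (τ-image v) → ∀ J → suc J < length (τ-image v) →
    U J ≡ a → U (suc J) ≡ v ! #a< U J
  τ-next (a ∷ v) U hU zero    (s≤s l) _   = trans (hU 1 (s≤s l)) (τ-image-starts-with-a v l)
  τ-next (a ∷ v) U hU (suc J) (s≤s l) UJ≡a =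
    trans (τ-next v (U ∘ suc) (λ i p → hU (suc i) (s≤s p)) J l UJ≡a)
      (cong ((a ∷ v) !_) (sym (trans (#a<-suc U J) (cong (λ z → isA z + #a< (U ∘ suc) J) (hU 0 (s≤s z≤n))))))
  τ-next (b ∷ v) U hU zero       l _ = hU 1 (s≤s (s≤s z≤n))
  τ-next (b ∷ v) U hU (suc zero) l UJ≡a with () ← trans (sym UJ≡a) (hU 1 (s≤s (s≤s z≤n)))
  τ-next (b ∷ v) U hU (suc (suc J)) (s≤s (s≤s l)) UJ≡a =
    trans (τ-next v (U ∘ suc ∘ suc) (λ i p → hU (suc (suc i)) (s≤s (s≤s p))) J l UJ≡a)
      (cong ((b ∷ v) !_) (sym (trans (#a<-suc U (suc J))
        (cong₂ (λ z w → isA z + w) (hU 0 (s≤s z≤n))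
          (trans (#a<-suc (U ∘ suc) J) (cong (λ z → isA z + #a< (U ∘ suc ∘ suc) J) (hU 1 (s≤s (s≤s z≤n)))))))))

  τ-no-bb : ∀ v U → OccursIn U 0 (τ-image v) → ∀ J → suc J < length (τ-image v) → U J ≡ b → U (suc J) ≡ a
  τ-no-bb (a ∷ v) U hU zero          _ UJ≡b with () ← trans (sym UJ≡b) (hU 0 (s≤s z≤n))
  τ-no-bb (a ∷ v) U hU (suc J)       (s≤s l) UJ≡b = τ-no-bb v (U ∘ suc) (λ i p → hU (suc i) (s≤s p)) J l UJ≡b
  τ-no-bb (b ∷ v) U hU zero          _ UJ≡b with () ← trans (sym UJ≡b) (hU 0 (s≤s z≤n))
  τ-no-bb (b ∷ v) U hU (suc zero)    (s≤s (s≤s l)) _ = trans (hU 2 (s≤s (s≤s l))) (τ-image-starts-with-a v l)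
  τ-no-bb (b ∷ v) U hU (suc (suc J)) (s≤s (s≤s l)) UJ≡b =
    τ-no-bb v (U ∘ suc ∘ suc) (λ i p → hU (suc (suc i)) (s≤s (s≤s p))) J l UJ≡b

-- With X = s_n and
-- Y = s_{n-1}, c_α = μ(u) for μ : a ↦ X, b ↦ Y and u the limit of the
-- standard words with exponents d_{n+1}, d_{n+2}, …; moreover u = τ(u') with
-- u' the limit for d_{n+1} - 1, d_{n+2}, …  Inside this block structure we
-- locate the conjugates C_r X.
module Decomposition (d : ℕ → ℕ) (d-pos : ∀ i → 1 ≤ i → 1 ≤ d i) (n' : ℕ) where
  open Words
  open StandardWords
  open Substitutions

  n : ℕ
  n = suc n'

  X Y : Word
  X = sw d (suc n)
  Y = sw d n

  Q R : ℕ
  Q = length X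
  R = length Y

  T : ℕ → Letter
  T = cα d

  d-admissible : Admissible d
  d-admissible i 2≤i = d-pos i (≤-trans (s≤s z≤n) 2≤i)

  g : ℕ → ℕ
  g i = d (i + n)

  g' : ℕ → ℕ
  g' zero          = 0
  g' (suc zero)    = d (1 + n) ∸ 1
  g' (suc (suc i)) = d (suc (suc i) + n)

  g-admissible : Admissible g
  g-admissible i _ = d-pos (i + n) (≤-trans (s≤s z≤n) (m≤n+m n i))

  g'-admissible : Admissible g'
  g'-admissible (suc (suc i)) _       = g-admissible (suc (suc i)) (s≤s (s≤s z≤n))
  g'-admissible (suc zero)    (s≤s ())

  u u' : ℕ → Letter
  u  = limit g
  u' = limit g'

  μ : Letter → Word
  μ a = X
  μ b = Y

  open Substitution μ

  image-sw : ∀ m → image (sw g m) ≡ sw d (m + n)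
  image-sw zero          = ++-identityʳ Y
  image-sw (suc zero)    = ++-identityʳ X
  image-sw (suc (suc m)) = trans (image-++ (pow (sw g (suc m)) (g (suc m))) (sw g m))
    (cong₂ _++_ (trans (image-pow (sw g (suc m)) (g (suc m))) (cong (λ z → pow z (g (suc m))) (image-sw (suc m)))) (image-sw m))

  start : ℕ → ℕ
  start = blockStart u

  block : ∀ J → OccursIn T (start J) (μ (u J))
  block J = block-occurs (sw g (suc (suc J))) u T
    (λ i i< → sym (limit-agree g g-admissible J i i<))
    (λ i i< → trans (sym (limit-agree d d-admissible (J + n) i (subst (λ z → i < length z) (image-sw (suc (suc J))) i<)))
                    (cong (_! i) (sym (image-sw (suc (suc J))))))
    J (length-grows g g-admissible J)

  τ-image-sw : ∀ m → τ-image (sw g' (suc m)) ≡ sw g (suc m)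
  τ-image-sw zero          = refl
  τ-image-sw (suc zero)    = trans (τ-image-++ (pow (a ∷ []) (g' 1)) (b ∷ []))
    (trans (cong (_++ a ∷ b ∷ []) (τ-image-pow (a ∷ []) (g' 1))) (a^k-ab (d (1 + n)) (d-pos (1 + n) (s≤s z≤n))))
    where
    a^k-ab : ∀ k → 1 ≤ k → pow (a ∷ []) (k ∸ 1) ++ a ∷ b ∷ [] ≡ pow (a ∷ []) k ++ b ∷ []
    a^k-ab (suc zero)    _ = refl
    a^k-ab (suc (suc k)) _ = cong (a ∷_) (a^k-ab (suc k) (s≤s z≤n))
  τ-image-sw (suc (suc m)) = trans (τ-image-++ (pow (sw g' (suc (suc m))) (g' (suc (suc m)))) (sw g' (suc m)))
    (cong₂ _++_ (trans (τ-image-pow (sw g' (suc (suc m))) (g' (suc (suc m))))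
                       (cong (λ z → pow z (g (suc (suc m)))) (τ-image-sw (suc m))))
                (τ-image-sw m))

  private
    u-begins-with-τ : ∀ J → OccursIn u 0 (τ-image (sw g' (3 + J)))
    u-begins-with-τ J i i< = trans (sym (limit-agree g g-admissible (suc J) i (subst (λ z → i < length z) (τ-image-sw (2 + J)) i<)))
                                   (cong (_! i) (sym (τ-image-sw (2 + J))))
    long-enough : ∀ J → suc J < length (τ-image (sw g' (3 + J)))
    long-enough J = subst (λ z → suc J < length z) (sym (τ-image-sw (2 + J))) (length-grows g g-admissible (suc J))

  u-after-a : ∀ J → u J ≡ a → u (suc J) ≡ u' (#a< u J)
  u-after-a J uJ≡a = trans (τ-next (sw g' (3 + J)) u (u-begins-with-τ J) J (long-enough J) uJ≡a)
    (limit-agree g' g'-admissible (suc J) (#a< u J)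
      (≤-trans (s≤s (#a<-≤ u J)) (≤-trans (n≤1+n _) (length-grows g' g'-admissible (suc J)))))

  u-after-b : ∀ J → u J ≡ b → u (suc J) ≡ a
  u-after-b J uJ≡b = τ-no-bb (sw g' (3 + J)) u (u-begins-with-τ J) J (long-enough J) uJ≡b

  u-starts-with-a : u 0 ≡ a
  u-starts-with-a = limit-starts-with-a g g-admissible 0 (d-pos (1 + n) (s≤s z≤n))

  open AlmostCommute (almostCommute d n) public

  Y⊑X : Y ⊑ X
  Y⊑X = ⊑-step d n' (d-pos (suc n') (s≤s z≤n))

  R≥1 : 1 ≤ R
  R≥1 = length-pos d n

  Q≥1 : 1 ≤ Q
  Q≥1 = length-pos d (suc n)

  |common| : Q + R ≡ length common + 2
  |common| = almostCommute-length (almostCommute d n)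

  common⊑XY : common ⊑ X ++ Y
  common⊑XY = x ∷ y ∷ [] , uv≡

  common⊑YX : common ⊑ Y ++ X
  common⊑YX = y ∷ x ∷ [] , vu≡

  block-a : ∀ J → u J ≡ a → OccursIn T (start J) X
  block-a J uJ≡a = subst (λ c → OccursIn T (start J) (μ c)) uJ≡a (block J)

  block-b : ∀ J → u J ≡ b → OccursIn T (start J) Y
  block-b J uJ≡b = subst (λ c → OccursIn T (start J) (μ c)) uJ≡b (block J)

  start-a : ∀ J → u J ≡ a → start (suc J) ≡ start J + Q
  start-a J uJ≡a = cong (λ c → start J + length (μ c)) uJ≡a

  start-b : ∀ J → u J ≡ b → start (suc J) ≡ start J + R
  start-b J uJ≡b = cong (λ c → start J + length (μ c)) uJ≡b

  -- A b-block is followed by an a-block, so Y X occurs at its start.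
  block-bYX : ∀ J → u J ≡ b → OccursIn T (start J) (Y ++ X)
  block-bYX J uJ≡b = OccursIn-join T (start J) Y X (block-b J uJ≡b)
    (subst (λ z → OccursIn T z X) (start-b J uJ≡b) (block-a (suc J) (u-after-b J uJ≡b)))

  private
    r<Q⇒r≤common : ∀ r → r < Q → r ≤ length common
    r<Q⇒r≤common r r<Q = +-cancelʳ-≤ 2 r (length common)
      (≤-trans (≤-reflexive (+-suc r 1)) (≤-trans (+-mono-≤ r<Q R≥1) (≤-reflexive |common|)))

    r+2≤R⇒Q+r≤common : ∀ r → r + 2 ≤ R → Q + r ≤ length common
    r+2≤R⇒Q+r≤common r r+2≤R = +-cancelʳ-≤ 2 (Q + r) (length common)
      (≤-trans (≤-reflexive (+-assoc Q r 2)) (≤-trans (+-monoʳ-≤ Q r+2≤R) (≤-reflexive |common|)))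

  -- In an a-block, C_r X occurs at every offset r < |X|: X = A B with |A| = r,
  -- B ends the block, and the next block (X or Y X) begins with A.
  conjugate-in-a-block : ∀ J r → u J ≡ a → r < Q → OccursIn T (start J + r) (C r X)
  conjugate-in-a-block J r uJ≡a r<Q = OccursIn-join T (start J + r) B A B-occurs A-occurs
    where
    split = splitAt X r (<⇒≤ r<Q)
    A = take r X
    B = drop r X
    X≡AB : X ≡ A ++ B
    X≡AB = proj₁ (proj₂ (proj₂ split))
    |A| : length A ≡ r
    |A| = proj₂ (proj₂ (proj₂ split))
    r+|B| : r + length B ≡ Q
    r+|B| = trans (cong (_+ length B) (sym |A|)) (trans (sym (length-++ A)) (cong length (sym X≡AB)))
    B-occurs : OccursIn T (start J + r) B
    B-occurs = subst (λ z → OccursIn T (start J + z) B) |A| (OccursIn-++ʳ T (start J) A B (subst (OccursIn T (start J)) X≡AB (block-a J uJ≡a)))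
    A⊑X : A ⊑ X
    A⊑X = B , X≡AB
    A⊑YX : A ⊑ Y ++ X
    A⊑YX = ⊑-trans (⊑-by-length A common (X ++ Y) (⊑-trans A⊑X (⊑-++ X Y)) common⊑XY
                      (subst (_≤ length common) (sym |A|) (r<Q⇒r≤common r r<Q))) common⊑YX
    A-at-next-block : ∀ c → u (suc J) ≡ c → OccursIn T (start J + Q) A
    A-at-next-block a uJ+1≡a = OccursIn-⊑ T (start J + Q) A X A⊑X
      (subst (λ z → OccursIn T z X) (start-a J uJ≡a) (block-a (suc J) uJ+1≡a))
    A-at-next-block b uJ+1≡b = OccursIn-⊑ T (start J + Q) A (Y ++ X) A⊑YX
      (subst (λ z → OccursIn T z (Y ++ X)) (start-a J uJ≡a) (block-bYX (suc J) uJ+1≡b))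
    A-occurs : OccursIn T (start J + r + length B) A
    A-occurs = subst (λ z → OccursIn T z A) (trans (cong (start J +_) (sym r+|B|)) (sym (+-assoc (start J) r (length B))))
      (A-at-next-block (u (suc J)) refl)

  -- In a b-block, C_r X occurs at offset r whenever r + 2 ≤ |Y|: then
  -- X A ⊑ common ⊑ Y X with X = A B, so A B A occurs at the start of the block.
  conjugate-in-b-block : ∀ J r → u J ≡ b → r + 2 ≤ R → OccursIn T (start J + r) (C r X)
  conjugate-in-b-block J r uJ≡b r+2≤R =
    subst (λ z → OccursIn T (start J + z) (B ++ A)) |A| (OccursIn-++ʳ T (start J) A (B ++ A) ABA-occurs)
    where
    r≤R : r ≤ R
    r≤R = ≤-trans (m≤m+n r 2) r+2≤R
    split = splitAt X r (≤-trans r≤R (⊑-length Y⊑X))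
    A = take r X
    B = drop r X
    X≡AB : X ≡ A ++ B
    X≡AB = proj₁ (proj₂ (proj₂ split))
    |A| : length A ≡ r
    |A| = proj₂ (proj₂ (proj₂ split))
    A⊑Y : A ⊑ Y
    A⊑Y = ⊑-by-length A Y X (B , X≡AB) Y⊑X (subst (_≤ R) (sym |A|) r≤R)
    XA⊑YX : X ++ A ⊑ Y ++ X
    XA⊑YX = ⊑-trans (⊑-by-length (X ++ A) common (X ++ Y) (⊑-cong X A⊑Y) common⊑XY
      (subst (_≤ length common) (sym (trans (length-++ X) (cong (Q +_) |A|))) (r+2≤R⇒Q+r≤common r r+2≤R))) common⊑YX
    ABA-occurs : OccursIn T (start J) (A ++ (B ++ A))
    ABA-occurs = subst (OccursIn T (start J)) (trans (cong (_++ A) X≡AB) (++-assoc A B A))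
      (OccursIn-⊑ T (start J) (X ++ A) (Y ++ X) XA⊑YX (block-bYX J uJ≡b))

  -- Writing Y = A c and X = A B (as Y ⊑ X), the equation X Y = common x y
  -- forces common = A G with G x = B A.
  record LastLetterSplit : Set where
    field
      A B G   : Word
      c       : Letter
      Y≡      : Y ≡ A ++ c ∷ []
      X≡      : X ≡ A ++ B
      common≡ : common ≡ A ++ G
      Gx≡     : G ++ x ∷ [] ≡ B ++ A

  lastLetterSplit : LastLetterSplit
  lastLetterSplit = record { A = A ; B = B ; G = G ; c = c ; Y≡ = Y≡Ac ; X≡ = X≡AB ; common≡ = common≡AG ; Gx≡ = Gx≡BA }
    where
    Ac = unsnoc Y R≥1
    A = proj₁ Ac
    c = proj₁ (proj₂ Ac)
    Y≡Ac : Y ≡ A ++ c ∷ []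
    Y≡Ac = proj₂ (proj₂ Ac)
    Z = proj₁ Y⊑X
    B = c ∷ Z
    X≡AB : X ≡ A ++ B
    X≡AB = trans (proj₂ Y⊑X) (trans (cong (_++ Z) Y≡Ac) (++-assoc A (c ∷ []) Z))
    commonx≡ABA : common ++ x ∷ [] ≡ A ++ B ++ A
    commonx≡ABA = proj₁ (∷ʳ-injective (common ++ x ∷ []) (A ++ B ++ A) (begin
      (common ++ x ∷ []) ++ y ∷ []   ≡⟨ ++-assoc common (x ∷ []) (y ∷ []) ⟩
      common ++ x ∷ y ∷ []           ≡⟨ sym uv≡ ⟩
      X ++ Y                         ≡⟨ cong₂ _++_ X≡AB Y≡Ac ⟩
      (A ++ B) ++ (A ++ c ∷ [])      ≡⟨ ++-assoc A B (A ++ c ∷ []) ⟩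
      A ++ (B ++ (A ++ c ∷ []))      ≡⟨ cong (A ++_) (sym (++-assoc B A (c ∷ []))) ⟩
      A ++ ((B ++ A) ++ c ∷ [])      ≡⟨ sym (++-assoc A (B ++ A) (c ∷ [])) ⟩
      (A ++ B ++ A) ++ c ∷ []        ∎))
      where open ≡-Reasoning
    |Y| : R ≡ length A + 1
    |Y| = trans (cong length Y≡Ac) (length-++ A)
    |A|≤common : length A ≤ length common
    |A|≤common = +-cancelʳ-≤ 1 (length A) (length common) (≤-trans (≤-reflexive (sym |Y|))
      (+-cancelʳ-≤ 1 R (length common + 1) (≤-trans (≤-reflexive (+-comm R 1)) (≤-trans (+-monoˡ-≤ R Q≥1)
        (≤-trans (≤-reflexive |common|) (≤-reflexive (sym (+-assoc (length common) 1 1))))))))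
    A⊑common : A ⊑ common
    A⊑common = ⊑-by-length A common (common ++ x ∷ []) (B ++ A , commonx≡ABA) (⊑-++ common (x ∷ [])) |A|≤common
    G = proj₁ A⊑common
    common≡AG : common ≡ A ++ G
    common≡AG = proj₂ A⊑common
    Gx≡BA : G ++ x ∷ [] ≡ B ++ A
    Gx≡BA = ++-cancelˡ A (G ++ x ∷ []) (B ++ A)
      (trans (sym (++-assoc A G (x ∷ []))) (trans (cong (_++ x ∷ []) (sym common≡AG)) commonx≡ABA))

  -- At offset |Y| - 1 of a b-block starts a factor of length |X| whose height
  -- differs from |X|_b: it is the conjugate B A of X with its last letter x
  -- replaced by y, since Y X = common y x = A (G y) x.
  record NearMiss (p : ℕ) : Set where
    field
      word    : Word
      occurs  : OccursIn T p word
      length≡ : length word ≡ Q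
      #b≢     : #b word ≢ #b X

  near-miss-in-b-block : ∀ J → u J ≡ b → NearMiss (start J + (R ∸ 1))
  near-miss-in-b-block J uJ≡b = record { word = F ; occurs = F-occurs ; length≡ = |F| ; #b≢ = #bF≢ }
    where
    open LastLetterSplit lastLetterSplit
    F = G ++ y ∷ []
    YX≡AFx : Y ++ X ≡ A ++ (F ++ x ∷ [])
    YX≡AFx = trans vu≡ (trans (cong (_++ y ∷ x ∷ []) common≡) (trans (++-assoc A G (y ∷ x ∷ []))
      (cong (A ++_) (sym (++-assoc G (y ∷ []) (x ∷ []))))))
    |A|≡R-1 : length A ≡ R ∸ 1
    |A|≡R-1 = sym (trans (cong (λ w → length w ∸ 1) Y≡) (trans (cong (_∸ 1) (length-++ A)) (m+n∸n≡m (length A) 1)))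
    F-occurs : OccursIn T (start J + (R ∸ 1)) F
    F-occurs = subst (λ z → OccursIn T (start J + z) F) |A|≡R-1
      (OccursIn-++ˡ T (start J + length A) F (x ∷ [])
        (OccursIn-++ʳ T (start J) A (F ++ x ∷ []) (subst (OccursIn T (start J)) YX≡AFx (block-bYX J uJ≡b))))
    |F| : length F ≡ Q
    |F| = trans (length-++ G) (trans (sym (length-++ G)) (trans (cong length Gx≡) (trans (length-comm B A) (cong length (sym X≡)))))
    #b-single : ∀ {x y} → x ≢ y → #b (x ∷ []) ≢ #b (y ∷ [])
    #b-single {a} {a} x≢y _ = x≢y refl
    #b-single {b} {b} x≢y _ = x≢y refl
    #bF≢ : #b F ≢ #b X
    #bF≢ #bF≡#bX = #b-single x≢y (+-cancelˡ-≡ (#b G) _ _ (sym (begin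
      #b G + #b (y ∷ [])   ≡⟨ sym (#b-++ G (y ∷ [])) ⟩
      #b F                 ≡⟨ #bF≡#bX ⟩
      #b X                 ≡⟨ cong #b X≡ ⟩
      #b (A ++ B)          ≡⟨ #b-comm A B ⟩
      #b (B ++ A)          ≡⟨ cong #b (sym Gx≡) ⟩
      #b (G ++ x ∷ [])     ≡⟨ #b-++ G (x ∷ []) ⟩
      #b G + #b (x ∷ [])   ∎)))
      where open ≡-Reasoning

-- The text is cut into consecutive
-- blocks (block J starts at pos J and has length len J); an occurrence can
-- only start at offset k of a block, and block J contains one iff hit J = 1.
-- Then the number of occurrences before offset k of block J is the number of
-- hitting blocks before J.
module Counting where

  occCount-occurs : ∀ d w t → Occurs d w t → occCount d w (suc t) ≡ suc (occCount d w t)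
  occCount-occurs d w t o = begin
    length (filter P? (upTo (suc t)))                    ≡⟨ cong (λ z → length (filter P? z)) (sym (upTo-∷ʳ t)) ⟩
    length (filter P? (upTo t ++ t ∷ []))                ≡⟨ cong length (filter-++ P? (upTo t) (t ∷ [])) ⟩
    length (filter P? (upTo t) ++ filter P? (t ∷ []))    ≡⟨ length-++ (filter P? (upTo t)) ⟩
    occCount d w t + length (filter P? (t ∷ []))         ≡⟨ cong (λ z → occCount d w t + length z) (filter-accept P? o) ⟩
    occCount d w t + 1                                   ≡⟨ +-comm _ 1 ⟩
    suc (occCount d w t)                                 ∎
    where
    open ≡-Reasoning
    P? : ∀ t → Dec (Occurs d w t)
    P? t = factor d t (length w) ≟W w

  occCount-misses : ∀ d w t → ¬ Occurs d w t → occCount d w (suc t) ≡ occCount d w t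
  occCount-misses d w t o = begin
    length (filter P? (upTo (suc t)))                    ≡⟨ cong (λ z → length (filter P? z)) (sym (upTo-∷ʳ t)) ⟩
    length (filter P? (upTo t ++ t ∷ []))                ≡⟨ cong length (filter-++ P? (upTo t) (t ∷ [])) ⟩
    length (filter P? (upTo t) ++ filter P? (t ∷ []))    ≡⟨ length-++ (filter P? (upTo t)) ⟩
    occCount d w t + length (filter P? (t ∷ []))         ≡⟨ cong (λ z → occCount d w t + length z) (filter-reject P? o) ⟩
    occCount d w t + 0                                   ≡⟨ +-identityʳ _ ⟩
    occCount d w t                                       ∎
    where
    open ≡-Reasoning
    P? : ∀ t → Dec (Occurs d w t)
    P? t = factor d t (length w) ≟W w

  module Blocks
    (len : ℕ → ℕ) (len-pos : ∀ J → 1 ≤ len J)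
    (pos : ℕ → ℕ) (pos-zero : pos 0 ≡ 0) (pos-suc : ∀ J → pos (suc J) ≡ pos J + len J)
    (hit : ℕ → ℕ) (hit01 : ∀ J → hit J ≡ 0 ⊎ hit J ≡ 1) (k : ℕ)
    (Occ : ℕ → Set) (count : ℕ → ℕ) (count-zero : count 0 ≡ 0)
    (count-occurs : ∀ t → Occ t → count (suc t) ≡ suc (count t))
    (count-misses : ∀ t → ¬ Occ t → count (suc t) ≡ count t)
    (only-at-k : ∀ J r → r < len J → Occ (pos J + r) → r ≡ k × hit J ≡ 1)
    (at-k : ∀ J → hit J ≡ 1 → k < len J × Occ (pos J + k)) where

    hitsBefore : ℕ → ℕ
    hitsBefore zero    = 0
    hitsBefore (suc J) = hitsBefore J + hit J

    private
      count-suc : ∀ J r → count (pos J + suc r) ≡ count (suc (pos J + r))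
      count-suc J r = cong count (+-suc (pos J) r)

    count-up-to-k : ∀ J r → r ≤ k → r ≤ len J → count (pos J) ≡ hitsBefore J → count (pos J + r) ≡ hitsBefore J
    count-up-to-k J zero    _   _   h = trans (cong count (+-identityʳ (pos J))) h
    count-up-to-k J (suc r) r<k r<len h =
      trans (count-suc J r) (trans (count-misses (pos J + r) no-occ) (count-up-to-k J r (≤-trans (n≤1+n r) r<k) (≤-trans (n≤1+n r) r<len) h))
      where
      no-occ : ¬ Occ (pos J + r)
      no-occ o = <⇒≢ r<k (proj₁ (only-at-k J r r<len o))

    count-after-k : ∀ J r → k < r → r ≤ len J → count (pos J) ≡ hitsBefore J → count (pos J + r) ≡ hitsBefore J + hit J
    count-after-k J (suc r) (s≤s k≤r) r<len h with <-cmp r k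
    ... | tri< r<k _ _ = ⊥-elim (<⇒≱ r<k k≤r)
    ... | tri≈ _ refl _ = trans (count-suc J r) (at-offset-k (hit01 J))
      where
      before : count (pos J + r) ≡ hitsBefore J
      before = count-up-to-k J r ≤-refl (≤-trans (n≤1+n r) r<len) h
      at-offset-k : hit J ≡ 0 ⊎ hit J ≡ 1 → count (suc (pos J + r)) ≡ hitsBefore J + hit J
      at-offset-k (inj₁ h0) = trans (count-misses (pos J + r) (λ o → 0≢1+n (trans (sym h0) (proj₂ (only-at-k J r r<len o)))))
        (trans before (trans (sym (+-identityʳ (hitsBefore J))) (cong (hitsBefore J +_) (sym h0))))
      at-offset-k (inj₂ h1) = trans (count-occurs (pos J + r) (proj₂ (at-k J h1)))
        (trans (cong suc before) (trans (+-comm 1 (hitsBefore J)) (cong (hitsBefore J +_) (sym h1))))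
    ... | tri> _ _ k<r = trans (count-suc J r)
      (trans (count-misses (pos J + r) (λ o → <⇒≢ k<r (sym (proj₁ (only-at-k J r r<len o)))))
        (count-after-k J r k<r (≤-trans (n≤1+n r) r<len) h))

    count-at-block : ∀ J → count (pos J) ≡ hitsBefore J
    count-at-block zero = trans (cong count pos-zero) count-zero
    count-at-block (suc J) with k <? len J
    ... | yes k<len = trans (cong count (pos-suc J)) (count-after-k J (len J) k<len ≤-refl (count-at-block J))
    ... | no  k≮len = trans (cong count (pos-suc J))
      (trans (count-up-to-k J (len J) (≮⇒≥ k≮len) ≤-refl (count-at-block J)) (no-hit (hit01 J)))
      where
      no-hit : hit J ≡ 0 ⊎ hit J ≡ 1 → hitsBefore J ≡ hitsBefore J + hit J
      no-hit (inj₁ h0) = trans (sym (+-identityʳ (hitsBefore J))) (cong (hitsBefore J +_) (sym h0))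
      no-hit (inj₂ h1) = ⊥-elim (k≮len (proj₁ (at-k J h1)))

    count-at-hit : ∀ J → hit J ≡ 1 → count (pos J + k) ≡ hitsBefore J
    count-at-hit J h1 = count-up-to-k J k ≤-refl (<⇒≤ (proj₁ (at-k J h1))) (count-at-block J)

    locate : ∀ p → Σ ℕ λ J → Σ ℕ λ r → r < len J × p ≡ pos J + r
    locate zero = 0 , 0 , len-pos 0 , sym (trans (+-identityʳ (pos 0)) pos-zero)
    locate (suc p) with locate p
    ... | J , r , r<len , p≡ with suc r <? len J
    ...   | yes r+1<len = J , suc r , r+1<len , trans (cong suc p≡) (sym (+-suc (pos J) r))
    ...   | no  r+1≮len = suc J , 0 , len-pos (suc J) , (begin
      suc p             ≡⟨ cong suc p≡ ⟩
      suc (pos J + r)   ≡⟨ sym (+-suc (pos J) r) ⟩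
      pos J + suc r     ≡⟨ cong (pos J +_) (≤-antisym r<len (≮⇒≥ r+1≮len)) ⟩
      pos J + len J     ≡⟨ sym (pos-suc J) ⟩
      pos (suc J)       ≡⟨ sym (+-identityʳ _) ⟩
      pos (suc J) + 0   ∎)
      where open ≡-Reasoning

module Occurrences (d : ℕ → ℕ) (d-pos : ∀ i → 1 ≤ i → 1 ≤ d i) (n' : ℕ) (k : ℕ) (k<Q : k < q d (suc n')) where
  open Words
  open StandardWords
  open CharacteristicWords using (PartialQuotients; exponents; CharLetter⇒limit)
  open Conjugates using (conjugates-distinct)
  open Substitutions using (isA; #a<)
  open Counting
  open Decomposition d d-pos n'

  W : Word
  W = C k X

  u-characteristic : ∀ t c → CharLetter (αcf d n 1) t c → c ≡ u t
  u-characteristic t c h = trans (CharLetter⇒limit (αcf d n 1) pq t c h) (limit-ext exponents≡g t)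
    where
    pq : PartialQuotients (αcf d n 1)
    pq (suc zero)    _ = m≤n+m 1 _
    pq (suc (suc j)) _ = d-pos (suc (suc (n + j))) (s≤s z≤n)
    exponents≡g : ∀ i → 1 ≤ i → exponents (αcf d n 1) i ≡ g i
    exponents≡g (suc zero)    _ = m+n∸n≡m (d (suc n)) 1
    exponents≡g (suc (suc j)) _ = cong (λ z → d (suc (suc z))) (+-comm n j)

  u'-characteristic : ∀ t c → CharLetter (αcf d n 0) t c → c ≡ u' t
  u'-characteristic t c h = trans (CharLetter⇒limit (αcf d n 0) pq t c h) (limit-ext exponents≡g' t)
    where
    pq : PartialQuotients (αcf d n 0)
    pq (suc zero)    _ = subst (1 ≤_) (sym (+-identityʳ _)) (d-pos (suc n) (s≤s z≤n))
    pq (suc (suc j)) _ = d-pos (suc (suc (n + j))) (s≤s z≤n)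
    exponents≡g' : ∀ i → 1 ≤ i → exponents (αcf d n 0) i ≡ g' i
    exponents≡g' (suc zero)    _ = cong (_∸ 1) (+-identityʳ (d (suc n)))
    exponents≡g' (suc (suc j)) _ = cong (λ z → d (suc (suc z))) (+-comm n j)

  -- By primitivity of X, W can start at offset r < |X| of a block carrying
  -- C_r X only if r = k.
  offset-is-k : ∀ p r → r < Q → OccursIn T p (C r X) → Occurs d W p → r ≡ k
  offset-is-k p r r<Q Cr-occurs o = sym (conjugates-distinct X Y (unimodular d n) k r k<Q r<Q
    (OccursIn-unique T p W (C r X) (Occurs→OccursIn d W p o) Cr-occurs (trans (length-C k X) (sym (length-C r X)))))

  -- W does not start at offset |Y| - 1 of a b-block: the factor there has the wrong height.
  not-at-last-offset : ∀ J → u J ≡ b → ¬ Occurs d W (start J + (R ∸ 1))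
  not-at-last-offset J uJ≡b o = NearMiss.#b≢ miss (trans (sym (cong #b W≡F)) (#b-C k X))
    where
    miss : NearMiss (start J + (R ∸ 1))
    miss = near-miss-in-b-block J uJ≡b
    W≡F : W ≡ NearMiss.word miss
    W≡F = OccursIn-unique T (start J + (R ∸ 1)) W (NearMiss.word miss) (Occurs→OccursIn d W (start J + (R ∸ 1)) o)
      (NearMiss.occurs miss) (trans (length-C k X) (sym (NearMiss.length≡ miss)))

  -- β = 1 if the b-blocks contain an occurrence of W, β = 0 otherwise.
  BlockB : ℕ → Set
  BlockB β = (β ≡ 1 × k + 2 ≤ R) ⊎ (β ≡ 0 × R ≤ k + 1)

  module Hits (β : ℕ) (β-spec : BlockB β) where

    hitL : Letter → ℕ
    hitL a = 1
    hitL b = β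

    hit : ℕ → ℕ
    hit J = hitL (u J)

    len : ℕ → ℕ
    len J = length (μ (u J))

    hit01 : ∀ J → hit J ≡ 0 ⊎ hit J ≡ 1
    hit01 J = hitL01 (u J)
      where
      β01 : BlockB β → β ≡ 0 ⊎ β ≡ 1
      β01 (inj₁ (β≡1 , _)) = inj₂ β≡1
      β01 (inj₂ (β≡0 , _)) = inj₁ β≡0
      hitL01 : ∀ c → hitL c ≡ 0 ⊎ hitL c ≡ 1
      hitL01 a = inj₂ refl
      hitL01 b = β01 β-spec

    len-pos : ∀ J → 1 ≤ len J
    len-pos J with u J
    ... | a = Q≥1
    ... | b = R≥1

    -- An occurrence inside a block starts at offset k, and only in hitting blocks:
    -- in an a-block by primitivity of X; in a b-block either r + 2 ≤ |Y| and
    -- primitivity applies, or r = |Y| - 1 and the factor there has the wrong height.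
    only-at-k' : ∀ J r c → u J ≡ c → r < length (μ c) → Occurs d W (start J + r) → r ≡ k × hitL c ≡ 1
    only-at-k' J r a uJ≡a r<Q o = offset-is-k (start J + r) r r<Q (conjugate-in-a-block J r uJ≡a r<Q) o , refl
    only-at-k' J r b uJ≡b r<R o with r + 2 ≤? R
    ... | yes r+2≤R = r≡k , β≡1 β-spec
      where
      r≡k : r ≡ k
      r≡k = offset-is-k (start J + r) r (≤-trans r<R (⊑-length Y⊑X)) (conjugate-in-b-block J r uJ≡b r+2≤R) o
      β≡1 : BlockB β → β ≡ 1
      β≡1 (inj₁ (β≡1 , _))    = β≡1
      β≡1 (inj₂ (_ , R≤k+1)) = ⊥-elim (<⇒≱ (≤-trans (≤-reflexive (sym (+-suc r 1))) r+2≤R) (subst (λ z → R ≤ z + 1) (sym r≡k) R≤k+1))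
    ... | no r+2≰R = ⊥-elim (not-at-last-offset J uJ≡b (subst (λ z → Occurs d W (start J + z)) r≡R-1 o))
      where
      r≡R-1 : r ≡ R ∸ 1
      r≡R-1 = sym (trans (cong (_∸ 1) (≤-antisym (≮⇒≥ (λ z → r+2≰R (subst (_≤ R) (sym (+-suc r 1)) z)))
                                                   (subst (_≤ R) (+-comm 1 r) r<R)))
                         (m+n∸n≡m r 1))

    only-at-k : ∀ J r → r < len J → Occurs d W (start J + r) → r ≡ k × hit J ≡ 1
    only-at-k J r = only-at-k' J r (u J) refl

    at-k' : ∀ J c → u J ≡ c → hitL c ≡ 1 → k < length (μ c) × Occurs d W (start J + k)
    at-k' J a uJ≡a _ = k<Q , OccursIn→Occurs d W (start J + k) (conjugate-in-a-block J k uJ≡a k<Q)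
    at-k' J b uJ≡b β≡1 = b-block β-spec
      where
      b-block : BlockB β → k < R × Occurs d W (start J + k)
      b-block (inj₁ (_ , k+2≤R)) = ≤-trans (≤-trans (n≤1+n (suc k)) (≤-reflexive (+-comm 2 k))) k+2≤R ,
                                   OccursIn→Occurs d W (start J + k) (conjugate-in-b-block J k uJ≡b k+2≤R)
      b-block (inj₂ (β≡0 , _))   = ⊥-elim (0≢1+n (trans (sym β≡0) β≡1))

    at-k : ∀ J → hit J ≡ 1 → k < len J × Occurs d W (start J + k)
    at-k J = at-k' J (u J) refl

    open Blocks len len-pos start refl (λ J → refl) hit hit01 k (Occurs d W) (occCount d W) refl
                (occCount-occurs d W) (occCount-misses d W) only-at-k at-k public

    first-occurrence : IsOcc d W 1 k
    first-occurrence = proj₂ (at-k 0 hit₀) , count-at-hit 0 hit₀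
      where
      hit₀ : hit 0 ≡ 1
      hit₀ = cong hitL u-starts-with-a

    record Located (i p : ℕ) : Set where
      field
        J       : ℕ
        p≡      : p ≡ start J + k
        hits    : hit J ≡ 1
        before  : hitsBefore J ≡ i ∸ 1

    locate-occurrence : ∀ i p → IsOcc d W i p → Located i p
    locate-occurrence i p (o , count≡) = record
      { J = J ; p≡ = p≡' ; hits = proj₂ onK
      ; before = trans (sym (count-at-hit J (proj₂ onK))) (trans (cong (occCount d W) (sym p≡')) count≡) }
      where
      L = locate p
      J = proj₁ L
      r = proj₁ (proj₂ L)
      onK : r ≡ k × hit J ≡ 1
      onK = only-at-k J r (proj₁ (proj₂ (proj₂ L))) (subst (Occurs d W) (proj₂ (proj₂ (proj₂ L))) o)
      p≡' : p ≡ start J + k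
      p≡' = trans (proj₂ (proj₂ (proj₂ L))) (cong (start J +_) (proj₁ onK))

    occurrence-at : ∀ i p J → 1 ≤ i → hit J ≡ 1 → hitsBefore J ≡ suc (i ∸ 1) → p ≡ start J + k → IsOcc d W (suc i) p
    occurrence-at i p J 1≤i hit≡1 before≡ p≡ = subst (Occurs d W) (sym p≡) (proj₂ (at-k J hit≡1)) ,
      trans (cong (occCount d W) p≡) (trans (count-at-hit J hit≡1) (trans before≡ (trans (+-comm 1 (i ∸ 1)) (m∸n+n≡m 1≤i))))

  private
    shift-k : ∀ s k Q → s + k + Q ≡ s + Q + k
    shift-k s k Q = trans (+-assoc s k Q) (trans (cong (s +_) (+-comm k Q)) (sym (+-assoc s Q k)))

  hit-every : (h : k + 2 ≤ R) → ∀ J → Hits.hit 1 (inj₁ (refl , h)) J ≡ 1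
  hit-every h J = hit≡1 (u J)
    where
    hit≡1 : ∀ c → Hits.hitL 1 (inj₁ (refl , h)) c ≡ 1
    hit≡1 a = refl
    hit≡1 b = refl

  hitsBefore-every : (h : k + 2 ≤ R) → ∀ J → Hits.hitsBefore 1 (inj₁ (refl , h)) J ≡ J
  hitsBefore-every h zero    = refl
  hitsBefore-every h (suc J) = trans (cong₂ _+_ (hitsBefore-every h J) (hit-every h J)) (+-comm J 1)

  hitsBefore-a : (h : R ≤ k + 1) → ∀ J → Hits.hitsBefore 0 (inj₂ (refl , h)) J ≡ #a< u J
  hitsBefore-a h zero    = refl
  hitsBefore-a h (suc J) = cong₂ _+_ (hitsBefore-a h J) (hit≡isA (u J))
    where
    hit≡isA : ∀ c → Hits.hitL 0 (inj₂ (refl , h)) c ≡ isA c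
    hit≡isA a = refl
    hit≡isA b = refl

  -- k + 2 ≤ q_{n-1}: every block holds one occurrence, so the gaps are the block
  -- lengths, read off u = c_{α_{n,1}}.
  gaps-every-block : k + 2 ≤ R → ∀ i → 1 ≤ i → ∀ p → IsOcc d W i p → GapStep d W (αcf d n 1) Q R i p
  gaps-every-block k+2≤R i 1≤i p occ = next-a , next-b
    where
    open Hits 1 (inj₁ (refl , k+2≤R))
    hitsBefore≡ : ∀ J → hitsBefore J ≡ J
    hitsBefore≡ = hitsBefore-every k+2≤R
    loc : Located i p
    loc = locate-occurrence i p occ
    J = Located.J loc
    J≡i-1 : J ≡ i ∸ 1
    J≡i-1 = trans (sym (hitsBefore≡ J)) (Located.before loc)
    next : ∀ L → start (suc J) ≡ start J + L → IsOcc d W (suc i) (p + L)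
    next L start≡ = occurrence-at i (p + L) (suc J) 1≤i
      (hit-every k+2≤R (suc J)) (trans (hitsBefore≡ (suc J)) (cong suc J≡i-1))
      (trans (cong (_+ L) (Located.p≡ loc)) (trans (shift-k (start J) k L) (cong (_+ k) (sym start≡))))
    next-a : CharLetter (αcf d n 1) (i ∸ 1) a → IsOcc d W (suc i) (p + Q)
    next-a h = next Q (start-a J uJ≡a)
      where
      uJ≡a : u J ≡ a
      uJ≡a = sym (trans (u-characteristic (i ∸ 1) a h) (cong u (sym J≡i-1)))
    next-b : CharLetter (αcf d n 1) (i ∸ 1) b → IsOcc d W (suc i) (p + R)
    next-b h = next R (start-b J uJ≡b)
      where
      uJ≡b : u J ≡ b
      uJ≡b = sym (trans (u-characteristic (i ∸ 1) b h) (cong u (sym J≡i-1)))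

  -- q_{n-1} ≤ k + 1: exactly the a-blocks hold occurrences; after the i-th one
  -- comes an a-block (gap q_n) or a b-block and then an a-block (gap
  -- q_n + q_{n-1}), according to the letter u'(i-1) of c_{α_n}.
  gaps-a-blocks : R ≤ k + 1 → ∀ i → 1 ≤ i → ∀ p → IsOcc d W i p → GapStep d W (αcf d n 0) Q (Q + R) i p
  gaps-a-blocks R≤k+1 i 1≤i p occ = next-a , next-b
    where
    open Hits 0 (inj₂ (refl , R≤k+1))
    hitsBefore≡ : ∀ J → hitsBefore J ≡ #a< u J
    hitsBefore≡ = hitsBefore-a R≤k+1
    hit⇒a : ∀ c → hitL c ≡ 1 → c ≡ a
    hit⇒a a _ = refl
    loc : Located i p
    loc = locate-occurrence i p occ
    J = Located.J loc
    uJ≡a : u J ≡ a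
    uJ≡a = hit⇒a (u J) (Located.hits loc)
    u-next : u (suc J) ≡ u' (i ∸ 1)
    u-next = trans (u-after-a J uJ≡a) (cong u' (trans (sym (hitsBefore≡ J)) (Located.before loc)))
    before-next : hitsBefore (suc J) ≡ suc (i ∸ 1)
    before-next = trans (cong₂ _+_ (Located.before loc) (cong hitL uJ≡a)) (+-comm (i ∸ 1) 1)
    p+Q≡ : p + Q ≡ start (suc J) + k
    p+Q≡ = trans (cong (_+ Q) (Located.p≡ loc)) (trans (shift-k (start J) k Q) (cong (_+ k) (sym (start-a J uJ≡a))))
    next-a : CharLetter (αcf d n 0) (i ∸ 1) a → IsOcc d W (suc i) (p + Q)
    next-a h = occurrence-at i (p + Q) (suc J) 1≤i (cong hitL uJ+1≡a) before-next p+Q≡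
      where
      uJ+1≡a : u (suc J) ≡ a
      uJ+1≡a = trans u-next (sym (u'-characteristic (i ∸ 1) a h))
    next-b : CharLetter (αcf d n 0) (i ∸ 1) b → IsOcc d W (suc i) (p + (Q + R))
    next-b h = occurrence-at i (p + (Q + R)) (suc (suc J)) 1≤i (cong hitL uJ+2≡a)
      (trans (cong₂ _+_ before-next (cong hitL uJ+1≡b)) (+-identityʳ _))
      (trans (sym (+-assoc p Q R)) (trans (cong (_+ R) p+Q≡) (trans (shift-k (start (suc J)) k R)
        (cong (_+ k) (sym (start-b (suc J) uJ+1≡b))))))
      where
      uJ+1≡b : u (suc J) ≡ b
      uJ+1≡b = trans u-next (sym (u'-characteristic (i ∸ 1) b h))
      uJ+2≡a : u (suc (suc J)) ≡ a
      uJ+2≡a = u-after-b (suc J) uJ+1≡b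

  first-occurrence : IsOcc d W 1 k
  first-occurrence with k + 2 ≤? R
  ... | yes k+2≤R = Hits.first-occurrence 1 (inj₁ (refl , k+2≤R))
  ... | no  k+2≰R = Hits.first-occurrence 0 (inj₂ (refl , ≤-pred (≤-trans (≰⇒> k+2≰R) (≤-reflexive (+-suc k 1)))))

corollary6p5 : (d : ℕ → ℕ) → (∀ i → 1 ≤ i → 1 ≤ d i) →
    (n : ℕ) → 1 ≤ n → (k : ℕ) → k < q d n →
    IsOcc d (C k (s d n)) 1 k
    × (k + 2 ≤ qprev d n → ∀ i → 1 ≤ i → ∀ p → IsOcc d (C k (s d n)) i p →
    GapStep d (C k (s d n)) (αcf d n 1) (q d n) (qprev d n) i p)
    × (qprev d n ≤ k + 1 → ∀ i → 1 ≤ i → ∀ p → IsOcc d (C k (s d n)) i p →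
    GapStep d (C k (s d n)) (αcf d n 0) (q d n) (q d n + qprev d n) i p)
corollary6p5 d d-pos zero    ()
corollary6p5 d d-pos (suc n') _ k k<q = first-occurrence , gaps-every-block , gaps-a-blocks
  where open Occurrences d d-pos n' k k<q
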